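{- Let $Z_n(y)=Z_n(y;1,1,0,0;0)$ for $n\ge 0$ (with $Z_0(y)=1$). Let $t=t(w)$ be the unique formal power series in $w$ with zero constant term satisfying $w=\frac{t}{(1+t)(1+yt)}$. Then $$\sum_{n\ge 0}Z_n(y)\,w^n=(1+t)(1+yt).$$
   Context: A staircase tableau of size $n$ is a filling of the Young diagram of staircase shape $(n,n-1,\dots,1)$ (English convention: row $r$ consists of columns $1,\dots,n+1-r$; the diagonal boxes are the last boxes of the rows) in which each box is empty or labeled by one of $\alpha,\beta,\gamma,\delta$, such that: no diagonal box is empty; every box in the same row and to the left of a $\beta$ or a $\delta$ is empty; every box in the same column and above an $\alpha$ or a $\gamma$ is empty. The type of $T$ is the word in $\{\bullet,\circ\}^n$ obtained by reading the diagonal boxes from northeast to southwest, writing $\bullet$ for $\alpha$ or $\delta$ and $\circ$ for $\beta$ or $\gamma$. Each empty box is assigned $q$ or $1$ according to the nearest labeled box to its right in its row and the nearest labeled box below it in its column: it gets $1$ if it sees a $\beta$ to its right; $q$ if it sees a $\delta$ to its right; $1$ if it sees an $\alpha$ or $\gamma$ to its right and an $\alpha$ or $\delta$ below it; $q$ if it sees an $\alpha$ or $\gamma$ to its right and a $\beta$ or $\gamma$ below it. The weight $\mathrm{wt}(T)$ is the product of all labels $\alpha,\beta,\gamma,\delta$ in $T$ and all assigned $q$'s. Let $t(T)$ be the number of $\bullet$'s in the type of $T$, and $Z_n(y;\alpha,\beta,\gamma,\delta;q)=\sum_T \mathrm{wt}(T)\,y^{t(T)}$, summed over all staircase tableaux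 of size $n$ (a polynomial, which may be evaluated at any values of the variables). -}

module Defs where

open import Data.Nat using (ℕ; zero; suc; _∸_; _<ᵇ_; _≡ᵇ_) renaming (_+_ to _+ℕ_)
open import Data.Integer using (ℤ; +_) renaming (_+_ to _+ℤ_; _*_ to _*ℤ_)
open import Data.List using (List; []; _∷_; [_]; map; concatMap; upTo; drop; foldr; filter; length)
open import Data.Maybe using (Maybe; just; nothing)
open import Data.Bool using (Bool; true; false; _∧_; _∨_; not; if_then_else_)
open import Relation.Binary.PropositionalEquality using (_≡_)
open import Data.Product using (Σ; _×_)

data Label : Set where
  α β γ δ : Label

Cell : Set
Cell = Maybe Label

-- A filling of the staircase shape (n, n-1, ..., 1): list of rows, row r
-- (0-indexed, top to bottom) is a list of n - r cells, columns 0-indexed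
-- left to right.  The diagonal box of row r is column n-1-r.
Filling : Set
Filling = List (List Cell)

cells : List Cell
cells = nothing ∷ just α ∷ just β ∷ just γ ∷ just δ ∷ []

words : ℕ → List (List Cell)
words zero    = [ [] ]
words (suc k) = concatMap (λ c → map (c ∷_) (words k)) cells

fillingsFrom : List ℕ → List Filling
fillingsFrom []       = [ [] ]
fillingsFrom (l ∷ ls) = concatMap (λ w → map (w ∷_) (fillingsFrom ls)) (words l)

rowLengths : ℕ → List ℕ
rowLengths zero    = []
rowLengths (suc n) = suc n ∷ rowLengths n

allFillings : ℕ → List Filling
allFillings n = fillingsFrom (rowLengths n)

nth : {A : Set} → A → List A → ℕ → A
nth d []       _       = d
nth d (x ∷ xs) zero    = x
nth d (x ∷ xs) (suc i) = nth d xs i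

row : Filling → ℕ → List Cell
row T r = nth [] T r

at : Filling → ℕ → ℕ → Cell
at T r c = nth nothing (row T r) c

allB : List ℕ → (ℕ → Bool) → Bool
allB xs p = foldr (λ x b → p x ∧ b) true xs

isEmpty : Cell → Bool
isEmpty nothing  = true
isEmpty (just _) = false

isβδ : Cell → Bool
isβδ (just β) = true
isβδ (just δ) = true
isβδ _        = false

isαγ : Cell → Bool
isαγ (just α) = true
isαγ (just γ) = true
isαγ _        = false

-- diagonal box entries that contribute • to the type (α or δ)
isαδ : Cell → Bool
isαδ (just α) = true
isαδ (just δ) = true
isαδ _        = false

isDiag : ℕ → ℕ → ℕ → Bool
isDiag n r c = suc (r +ℕ c) ≡ᵇ n

boxOK : ℕ → Filling → ℕ → ℕ → Bool
boxOK n T r c =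
     (not (isDiag n r c) ∨ not (isEmpty (at T r c)))
   ∧ (not (isβδ (at T r c)) ∨ allB (upTo c) (λ c' → isEmpty (at T r c')))
   ∧ (not (isαγ (at T r c)) ∨ allB (upTo r) (λ r' → isEmpty (at T r' c)))

isStaircase : ℕ → Filling → Bool
isStaircase n T = allB (upTo n) (λ r → allB (upTo (n ∸ r)) (λ c → boxOK n T r c))

staircaseTableaux : ℕ → List Filling
staircaseTableaux n = filter (λ T → Data.Bool.T? (isStaircase n T)) (allFillings n)
  where import Data.Bool

firstJust : List Cell → Cell
firstJust []             = nothing
firstJust (nothing ∷ xs) = firstJust xs
firstJust (just l ∷ xs)  = just l

rightOf : Filling → ℕ → ℕ → Cell
rightOf T r c = firstJust (drop (suc c) (row T r))

belowOf : ℕ → Filling → ℕ → ℕ → Cell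
belowOf n T r c = firstJust (map (λ r' → at T r' c) (drop (suc r) (upTo n)))

prodℤ : List ℤ → ℤ
prodℤ = foldr _*ℤ_ (+ 1)

sumℤ : List ℤ → ℤ
sumℤ = foldr _+ℤ_ (+ 0)

module Weight (a b g d q : ℤ) where
  labelWt : Label → ℤ
  labelWt α = a
  labelWt β = b
  labelWt γ = g
  labelWt δ = d

  -- weight (q or 1) of an empty box, from what it sees right / below
  emptyWt : Cell → Cell → ℤ
  emptyWt (just β) _        = + 1
  emptyWt (just δ) _        = q
  emptyWt (just α) (just α) = + 1
  emptyWt (just α) (just δ) = + 1
  emptyWt (just α) (just β) = q
  emptyWt (just α) (just γ) = q
  emptyWt (just γ) (just α) = + 1
  emptyWt (just γ) (just δ) = + 1
  emptyWt (just γ) (just β) = q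
  emptyWt (just γ) (just γ) = q
  emptyWt _        _        = + 1   -- never happens in a staircase tableau

  boxWt : ℕ → Filling → ℕ → ℕ → ℤ
  boxWt n T r c with at T r c
  ... | just l  = labelWt l
  ... | nothing = emptyWt (rightOf T r c) (belowOf n T r c)

  wt : ℕ → Filling → ℤ
  wt n T = prodℤ (concatMap (λ r → map (λ c → boxWt n T r c) (upTo (n ∸ r))) (upTo n))

typeCount : ℕ → Filling → ℕ
typeCount n T = length (filter (λ r → Data.Bool.T? (isαδ (at T r (n ∸ suc r)))) (upTo n))
  where import Data.Bool

-- Z n a b g d q k = coefficient of y^k in Z_n(y; a, b, g, d; q)
Z : ℕ → (a b g d q : ℤ) → ℕ → ℤ
Z n a b g d q k =
  sumℤ (map (Weight.wt a b g d q n)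
            (filter (λ T → typeCount n T Data.Nat.≟ k) (staircaseTableaux n)))
  where import Data.Nat

-- Formal power series in w with coefficients in ℤ[y] (embedded in
-- ℤ[[w, y]]):  s n k = coefficient of w^n y^k

Series : Set
Series = ℕ → ℕ → ℤ

_≈ₛ_ : Series → Series → Set
f ≈ₛ g = ∀ n k → f n k ≡ g n k

sumTo : ℕ → (ℕ → ℤ) → ℤ
sumTo n f = sumℤ (map f (upTo (suc n)))

_+ₛ_ : Series → Series → Series
(f +ₛ g) n k = f n k +ℤ g n k

_*ₛ_ : Series → Series → Series
(f *ₛ g) n k = sumTo n (λ i → sumTo k (λ j → f i j *ℤ g (n ∸ i) (k ∸ j)))

oneₛ : Series
oneₛ zero zero = + 1
oneₛ _    _    = + 0

wₛ : Series
wₛ (suc zero) zero = + 1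
wₛ _          _    = + 0

yₛ : Series
yₛ zero (suc zero) = + 1
yₛ _    _          = + 0

genZ : Series
genZ n k = Z n (+ 1) (+ 1) (+ 0) (+ 0) (+ 0) k

-- t has zero constant term (in w) and w = t / ((1+t)(1+yt)),
-- i.e. w · (1+t)(1+yt) = t
IsT : Series → Set
IsT t = (∀ k → t zero k ≡ + 0)
      × ((wₛ *ₛ ((oneₛ +ₛ t) *ₛ (oneₛ +ₛ (yₛ *ₛ t)))) ≈ₛ t)

-- With α = β = 1 and γ = δ = q = 0 every staircase tableau has weight 0 or 1.
-- Build a tableau from its bottom row upwards.  In a tableau of weight 1 the
-- topmost labels of the columns are all α or β, and only the number m of β's
-- among them matters for the next row: a new row either has β on its
-- diagonal and is otherwise empty (m ↦ m + 1), or it has α on its diagonal,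
-- adds a •, and keeps exactly j of the β columns for some 0 ≤ j ≤ m.
-- Writing P_m for the generating function of the ways to complete a tableau
-- from m β columns, P_0 = 1 + w P_1 + y w P_0 and P_{m+1} = P_m (1 + y w P_0),
-- so that Z = P_0 = (1 + w Z)(1 + y w Z) and t = w Z solves the equation.  No
-- other solution exists, as t = w (1 + t)(1 + y t) determines the
-- coefficients of t degree by degree.

module Submission where

open import Defs
open import Function using (_∘_; id)
open import Function.Bundles using (mk⇔)
open import Level using (0ℓ)
open import Data.Product using (Σ; _×_; _,_; proj₁; proj₂)
open import Data.Sum using (inj₁; inj₂)
open import Data.Nat using (ℕ; zero; suc; _∸_; _≤_; _<_; z≤n; s≤s; _≡ᵇ_; _≟_) renaming (_+_ to _+ℕ_)
import Data.Nat.Properties as ℕP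
open import Data.Integer using (ℤ; +_; _+_; _*_)
import Data.Integer.Properties as ℤP
open import Data.Integer.Tactic.RingSolver using (solve-∀)
open import Data.Bool using (Bool; true; false; _∧_; _∨_; not; if_then_else_; T?)
import Data.Bool.Properties as BP
open import Data.Bool.Solver using (module ∨-∧-Solver)
open import Data.Maybe using (just; nothing; _<∣>_)
open import Data.List using (List; []; _∷_; map; upTo; applyUpTo; _++_; concatMap; filter; length; drop)
import Data.List.Properties as LP
open import Data.List.Relation.Unary.All as All using (All; []; _∷_)
open import Data.List.Relation.Unary.All.Properties using (map⁺; concat⁺)
open import Relation.Nullary using (does; yes; no)
open import Relation.Unary using (Pred; Decidable)
open import Relation.Binary.PropositionalEquality
open ≡-Reasoning
open import Algebra.Properties.CommutativeSemigroup ℤP.+-commutativeSemigroup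
  using (interchange; x∙yz≈y∙xz)

-- Finite sums

∑< : ℕ → (ℕ → ℤ) → ℤ
∑< zero    f = + 0
∑< (suc n) f = f 0 + ∑< n (f ∘ suc)

infix 5 ∑<
syntax ∑< n (λ i → x) = ∑[ i < n ] x

sumℤ-applyUpTo : ∀ n (f : ℕ → ℤ) → sumℤ (applyUpTo f n) ≡ ∑< n f
sumℤ-applyUpTo zero    f = refl
sumℤ-applyUpTo (suc n) f = cong (_+_ (f 0)) (sumℤ-applyUpTo n (f ∘ suc))

sumTo≡∑< : ∀ n f → sumTo n f ≡ ∑< (suc n) f
sumTo≡∑< n f = trans (cong sumℤ (LP.map-upTo f (suc n))) (sumℤ-applyUpTo (suc n) f)

∑-cong< : ∀ n {f g : ℕ → ℤ} → (∀ i → i < n → f i ≡ g i) → ∑< n f ≡ ∑< n g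
∑-cong< zero    eq = refl
∑-cong< (suc n) eq = cong₂ _+_ (eq 0 (s≤s z≤n)) (∑-cong< n (λ i i<n → eq (suc i) (s≤s i<n)))

∑-cong : ∀ n {f g : ℕ → ℤ} → (∀ i → f i ≡ g i) → ∑< n f ≡ ∑< n g
∑-cong n eq = ∑-cong< n (λ i _ → eq i)

∑-vanishing : ∀ n (f : ℕ → ℤ) → (∀ i → i < n → f i ≡ + 0) → ∑< n f ≡ + 0
∑-vanishing zero    f eq = refl
∑-vanishing (suc n) f eq =
  cong₂ _+_ (eq 0 (s≤s z≤n)) (∑-vanishing n (f ∘ suc) (λ i i<n → eq (suc i) (s≤s i<n)))

∑-zero : ∀ n → ∑[ i < n ] + 0 ≡ + 0
∑-zero n = ∑-vanishing n (λ _ → + 0) (λ _ _ → refl)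

∑-distrib-+ : ∀ n (f g : ℕ → ℤ) → ∑[ i < n ] (f i + g i) ≡ ∑< n f + ∑< n g
∑-distrib-+ zero    f g = refl
∑-distrib-+ (suc n) f g =
  trans (cong (_+_ (f 0 + g 0)) (∑-distrib-+ n (f ∘ suc) (g ∘ suc))) (interchange (f 0) (g 0) _ _)

*-distribʳ-∑ : ∀ n c (f : ℕ → ℤ) → ∑< n f * c ≡ ∑[ i < n ] (f i * c)
*-distribʳ-∑ zero    c f = ℤP.*-zeroˡ c
*-distribʳ-∑ (suc n) c f =
  trans (ℤP.*-distribʳ-+ c (f 0) _) (cong (_+_ (f 0 * c)) (*-distribʳ-∑ n c (f ∘ suc)))

∑-last : ∀ n (f : ℕ → ℤ) → ∑< (suc n) f ≡ ∑< n f + f n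
∑-last zero    f = ℤP.+-comm (f 0) (+ 0)
∑-last (suc n) f = trans (cong (_+_ (f 0)) (∑-last n (f ∘ suc))) (sym (ℤP.+-assoc (f 0) _ _))

∑-comm : ∀ n m (f : ℕ → ℕ → ℤ) →
         ∑[ i < n ] ∑[ j < m ] f i j ≡ ∑[ j < m ] ∑[ i < n ] f i j
∑-comm zero    m f = sym (∑-zero m)
∑-comm (suc n) m f = begin
  ∑< m (f 0) + (∑[ i < n ] ∑< m (f (suc i)))       ≡⟨ cong (_+_ (∑< m (f 0))) (∑-comm n m (f ∘ suc)) ⟩
  ∑< m (f 0) + (∑[ j < m ] ∑[ i < n ] f (suc i) j) ≡⟨ sym (∑-distrib-+ m (f 0) (λ j → ∑[ i < n ] f (suc i) j)) ⟩
  ∑[ j < m ] (f 0 j + (∑[ i < n ] f (suc i) j))    ∎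

∑-only-head : ∀ n (f : ℕ → ℤ) → (∀ i → f (suc i) ≡ + 0) → ∑< (suc n) f ≡ f 0
∑-only-head n f eq = trans (cong (_+_ (f 0)) (∑-vanishing n (f ∘ suc) (λ i _ → eq i))) (ℤP.+-identityʳ (f 0))

∑-only-last : ∀ n (f : ℕ → ℤ) → (∀ i → i < n → f i ≡ + 0) → ∑< (suc n) f ≡ f n
∑-only-last n f eq =
  trans (∑-last n f) (trans (cong (_+ f n) (∑-vanishing n f eq)) (ℤP.+-identityˡ (f n)))

-- Power series

coeff-*ₛ : ∀ f g n k →
           (f *ₛ g) n k ≡ ∑[ i < suc n ] ∑[ j < suc k ] (f i j * g (n ∸ i) (k ∸ j))
coeff-*ₛ f g n k = trans (sumTo≡∑< n (λ i → sumTo k (λ j → f i j * g (n ∸ i) (k ∸ j))))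
                         (∑-cong (suc n) (λ i → sumTo≡∑< k (λ j → f i j * g (n ∸ i) (k ∸ j))))

shift : (ℕ → ℤ) → ℕ → ℤ
shift f zero    = + 0
shift f (suc k) = f k

shift-cong : ∀ {f g : ℕ → ℤ} → (∀ k → f k ≡ g k) → ∀ k → shift f k ≡ shift g k
shift-cong eq zero    = refl
shift-cong eq (suc k) = eq k

shift-+ : ∀ (f g : ℕ → ℤ) k → shift (λ x → f x + g x) k ≡ shift f k + shift g k
shift-+ f g zero    = refl
shift-+ f g (suc k) = refl

shift-∑ : ∀ m (F : ℕ → ℕ → ℤ) k → shift (λ x → ∑[ l < m ] F l x) k ≡ ∑[ l < m ] shift (F l) k
shift-∑ m F zero    = sym (∑-zero m)
shift-∑ m F (suc k) = refl

suc∸ : ∀ {n i} → i ≤ n → suc n ∸ i ≡ suc (n ∸ i)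
suc∸ = ℕP.+-∸-assoc 1

wₛ-*ₛ-zero : ∀ f k → (wₛ *ₛ f) 0 k ≡ + 0
wₛ-*ₛ-zero f k = trans (coeff-*ₛ wₛ f 0 k)
  (trans (ℤP.+-identityʳ _) (∑-vanishing (suc k) (λ j → wₛ 0 j * f 0 (k ∸ j)) (λ j _ → ℤP.*-zeroˡ (f 0 (k ∸ j)))))

wₛ-*ₛ-suc : ∀ f n k → (wₛ *ₛ f) (suc n) k ≡ f n k
wₛ-*ₛ-suc f n k = begin
  (wₛ *ₛ f) (suc n) k
    ≡⟨ coeff-*ₛ wₛ f (suc n) k ⟩
  (∑[ j < suc k ] (wₛ 0 j * f (suc n) (k ∸ j)))
    + (∑[ i < suc n ] ∑[ j < suc k ] (wₛ (suc i) j * f (n ∸ i) (k ∸ j)))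
    ≡⟨ cong₂ _+_ (∑-vanishing (suc k) (λ j → wₛ 0 j * f (suc n) (k ∸ j)) (λ j _ → ℤP.*-zeroˡ (f (suc n) (k ∸ j))))
                 (∑-only-head n (λ i → ∑[ j < suc k ] (wₛ (suc i) j * f (n ∸ i) (k ∸ j)))
                   (λ i → ∑-vanishing (suc k) (λ j → wₛ (suc (suc i)) j * f (n ∸ suc i) (k ∸ j))
                                       (λ j _ → ℤP.*-zeroˡ (f (n ∸ suc i) (k ∸ j))))) ⟩
  + 0 + (∑[ j < suc k ] (wₛ 1 j * f n (k ∸ j)))
    ≡⟨ ℤP.+-identityˡ _ ⟩
  ∑[ j < suc k ] (wₛ 1 j * f n (k ∸ j))
    ≡⟨ ∑-only-head k (λ j → wₛ 1 j * f n (k ∸ j)) (λ j → ℤP.*-zeroˡ (f n (k ∸ suc j))) ⟩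
  + 1 * f n k
    ≡⟨ ℤP.*-identityˡ _ ⟩
  f n k ∎

yₛ-*ₛ : ∀ f n k → (yₛ *ₛ f) n k ≡ shift (f n) k
yₛ-*ₛ f n k = begin
  (yₛ *ₛ f) n k
    ≡⟨ coeff-*ₛ yₛ f n k ⟩
  (∑[ j < suc k ] (yₛ 0 j * f n (k ∸ j)))
    + (∑[ i < n ] ∑[ j < suc k ] (yₛ (suc i) j * f (n ∸ suc i) (k ∸ j)))
    ≡⟨ cong (_+_ (∑[ j < suc k ] (yₛ 0 j * f n (k ∸ j))))
         (∑-vanishing n (λ i → ∑[ j < suc k ] (yₛ (suc i) j * f (n ∸ suc i) (k ∸ j)))
                        (λ i _ → ∑-vanishing (suc k) (λ j → yₛ (suc i) j * f (n ∸ suc i) (k ∸ j))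
                                                   (λ j _ → ℤP.*-zeroˡ (f (n ∸ suc i) (k ∸ j))))) ⟩
  (∑[ j < suc k ] (yₛ 0 j * f n (k ∸ j))) + + 0
    ≡⟨ ℤP.+-identityʳ _ ⟩
  ∑[ j < suc k ] (yₛ 0 j * f n (k ∸ j))
    ≡⟨ coefficient-of-y k ⟩
  shift (f n) k ∎
  where
  coefficient-of-y : ∀ k → ∑[ j < suc k ] (yₛ 0 j * f n (k ∸ j)) ≡ shift (f n) k
  coefficient-of-y zero    = ℤP.*-zeroˡ (+ 0)
  coefficient-of-y (suc k) = begin
    + 0 * f n (suc k) + (∑[ j < suc k ] (yₛ 0 (suc j) * f n (k ∸ j)))
      ≡⟨ cong₂ _+_ (ℤP.*-zeroˡ (f n (suc k)))
                   (∑-only-head k (λ j → yₛ 0 (suc j) * f n (k ∸ j)) (λ j → ℤP.*-zeroˡ (f n (k ∸ suc j)))) ⟩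
    + 0 + + 1 * f n k
      ≡⟨ trans (ℤP.+-identityˡ _) (ℤP.*-identityˡ _) ⟩
    f n k ∎

*ₛ-identityˡ : ∀ f → (oneₛ *ₛ f) ≈ₛ f
*ₛ-identityˡ f n k = begin
  (oneₛ *ₛ f) n k
    ≡⟨ coeff-*ₛ oneₛ f n k ⟩
  ∑[ i < suc n ] ∑[ j < suc k ] (oneₛ i j * f (n ∸ i) (k ∸ j))
    ≡⟨ ∑-only-head n (λ i → ∑[ j < suc k ] (oneₛ i j * f (n ∸ i) (k ∸ j)))
                (λ i → ∑-vanishing (suc k) (λ j → oneₛ (suc i) j * f (n ∸ suc i) (k ∸ j))
                                    (λ j _ → ℤP.*-zeroˡ (f (n ∸ suc i) (k ∸ j)))) ⟩
  ∑[ j < suc k ] (oneₛ 0 j * f n (k ∸ j))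
    ≡⟨ ∑-only-head k (λ j → oneₛ 0 j * f n (k ∸ j)) (λ j → ℤP.*-zeroˡ (f n (k ∸ suc j))) ⟩
  + 1 * f n k
    ≡⟨ ℤP.*-identityˡ _ ⟩
  f n k ∎

*ₛ-identityʳ : ∀ f → (f *ₛ oneₛ) ≈ₛ f
*ₛ-identityʳ f n k = begin
  (f *ₛ oneₛ) n k
    ≡⟨ coeff-*ₛ f oneₛ n k ⟩
  ∑[ i < suc n ] ∑[ j < suc k ] (f i j * oneₛ (n ∸ i) (k ∸ j))
    ≡⟨ ∑-only-last n (λ i → ∑[ j < suc k ] (f i j * oneₛ (n ∸ i) (k ∸ j)))
                     (λ i i<n → ∑-vanishing (suc k) (λ j → f i j * oneₛ (n ∸ i) (k ∸ j)) (λ j _ →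
         trans (cong (λ z → f i j * oneₛ z (k ∸ j)) (suc∸ i<n)) (ℤP.*-zeroʳ (f i j)))) ⟩
  ∑[ j < suc k ] (f n j * oneₛ (n ∸ n) (k ∸ j))
    ≡⟨ ∑-only-last k (λ j → f n j * oneₛ (n ∸ n) (k ∸ j)) (λ j j<k →
         trans (cong (λ z → f n j * oneₛ (n ∸ n) z) (suc∸ j<k)) (oneₛ-shifted (n ∸ n) (f n j))) ⟩
  f n k * oneₛ (n ∸ n) (k ∸ k)
    ≡⟨ cong₂ (λ a b → f n k * oneₛ a b) (ℕP.n∸n≡0 n) (ℕP.n∸n≡0 k) ⟩
  f n k * + 1
    ≡⟨ ℤP.*-identityʳ _ ⟩
  f n k ∎
  where
  oneₛ-shifted : ∀ a x {c} → x * oneₛ a (suc c) ≡ + 0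
  oneₛ-shifted zero    x = ℤP.*-zeroʳ x
  oneₛ-shifted (suc a) x = ℤP.*-zeroʳ x

*ₛ-distribʳ-+ₛ : ∀ f g h → ((f +ₛ g) *ₛ h) ≈ₛ ((f *ₛ h) +ₛ (g *ₛ h))
*ₛ-distribʳ-+ₛ f g h n k = begin
  ((f +ₛ g) *ₛ h) n k
    ≡⟨ coeff-*ₛ (f +ₛ g) h n k ⟩
  ∑[ i < suc n ] ∑[ j < suc k ] ((f i j + g i j) * h (n ∸ i) (k ∸ j))
    ≡⟨ ∑-cong (suc n) (λ i → trans
         (∑-cong (suc k) (λ j → ℤP.*-distribʳ-+ (h (n ∸ i) (k ∸ j)) (f i j) (g i j)))
         (∑-distrib-+ (suc k) (λ j → f i j * h (n ∸ i) (k ∸ j)) (λ j → g i j * h (n ∸ i) (k ∸ j)))) ⟩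
  ∑[ i < suc n ] ((∑[ j < suc k ] (f i j * h (n ∸ i) (k ∸ j))) + (∑[ j < suc k ] (g i j * h (n ∸ i) (k ∸ j))))
    ≡⟨ ∑-distrib-+ (suc n) (λ i → ∑[ j < suc k ] (f i j * h (n ∸ i) (k ∸ j)))
                           (λ i → ∑[ j < suc k ] (g i j * h (n ∸ i) (k ∸ j))) ⟩
  (∑[ i < suc n ] ∑[ j < suc k ] (f i j * h (n ∸ i) (k ∸ j)))
    + (∑[ i < suc n ] ∑[ j < suc k ] (g i j * h (n ∸ i) (k ∸ j)))
    ≡⟨ sym (cong₂ _+_ (coeff-*ₛ f h n k) (coeff-*ₛ g h n k)) ⟩
  (f *ₛ h) n k + (g *ₛ h) n k ∎

*ₛ-distribˡ-+ₛ : ∀ f g h → (h *ₛ (f +ₛ g)) ≈ₛ ((h *ₛ f) +ₛ (h *ₛ g))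
*ₛ-distribˡ-+ₛ f g h n k = begin
  (h *ₛ (f +ₛ g)) n k
    ≡⟨ coeff-*ₛ h (f +ₛ g) n k ⟩
  ∑[ i < suc n ] ∑[ j < suc k ] (h i j * (f (n ∸ i) (k ∸ j) + g (n ∸ i) (k ∸ j)))
    ≡⟨ ∑-cong (suc n) (λ i → trans
         (∑-cong (suc k) (λ j → ℤP.*-distribˡ-+ (h i j) (f (n ∸ i) (k ∸ j)) (g (n ∸ i) (k ∸ j))))
         (∑-distrib-+ (suc k) (λ j → h i j * f (n ∸ i) (k ∸ j)) (λ j → h i j * g (n ∸ i) (k ∸ j)))) ⟩
  ∑[ i < suc n ] ((∑[ j < suc k ] (h i j * f (n ∸ i) (k ∸ j))) + (∑[ j < suc k ] (h i j * g (n ∸ i) (k ∸ j))))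
    ≡⟨ ∑-distrib-+ (suc n) (λ i → ∑[ j < suc k ] (h i j * f (n ∸ i) (k ∸ j)))
                           (λ i → ∑[ j < suc k ] (h i j * g (n ∸ i) (k ∸ j))) ⟩
  (∑[ i < suc n ] ∑[ j < suc k ] (h i j * f (n ∸ i) (k ∸ j)))
    + (∑[ i < suc n ] ∑[ j < suc k ] (h i j * g (n ∸ i) (k ∸ j)))
    ≡⟨ sym (cong₂ _+_ (coeff-*ₛ h f n k) (coeff-*ₛ h g n k)) ⟩
  (h *ₛ f) n k + (h *ₛ g) n k ∎

_≈[≤_]_ : Series → ℕ → Series → Set
f ≈[≤ n ] g = ∀ i k → i ≤ n → f i k ≡ g i k

*ₛ-cong-≤ : ∀ {f f′ g g′} n → f ≈[≤ n ] f′ → g ≈[≤ n ] g′ → (f *ₛ g) ≈[≤ n ] (f′ *ₛ g′)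
*ₛ-cong-≤ {f} {f′} {g} {g′} n f≈f′ g≈g′ i k i≤n = begin
  (f *ₛ g) i k
    ≡⟨ coeff-*ₛ f g i k ⟩
  ∑[ a < suc i ] ∑[ j < suc k ] (f a j * g (i ∸ a) (k ∸ j))
    ≡⟨ ∑-cong< (suc i) (λ a a≤i → ∑-cong (suc k) (λ j → cong₂ _*_
         (f≈f′ a j (ℕP.≤-trans (ℕP.≤-pred a≤i) i≤n))
         (g≈g′ (i ∸ a) (k ∸ j) (ℕP.≤-trans (ℕP.m∸n≤m i a) i≤n)))) ⟩
  ∑[ a < suc i ] ∑[ j < suc k ] (f′ a j * g′ (i ∸ a) (k ∸ j))
    ≡⟨ sym (coeff-*ₛ f′ g′ i k) ⟩
  (f′ *ₛ g′) i k ∎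

-- The equation for t reads t = w · φ(t).
φ : Series → Series
φ t = (oneₛ +ₛ t) *ₛ (oneₛ +ₛ (yₛ *ₛ t))

φ-cong-≤ : ∀ {t t′} n → t ≈[≤ n ] t′ → φ t ≈[≤ n ] φ t′
φ-cong-≤ {t} {t′} n t≈t′ = *ₛ-cong-≤ n (λ i k i≤n → cong (_+_ (oneₛ i k)) (t≈t′ i k i≤n))
  (λ i k i≤n → cong (_+_ (oneₛ i k))
     (*ₛ-cong-≤ {yₛ} {yₛ} {t} {t′} n (λ _ _ _ → refl) t≈t′ i k i≤n))

φ-expand : ∀ t n k → φ t n k ≡ (oneₛ n k + (yₛ *ₛ t) n k) + (t n k + (t *ₛ (yₛ *ₛ t)) n k)
φ-expand t n k = begin
  φ t n k
    ≡⟨ *ₛ-distribʳ-+ₛ oneₛ t (oneₛ +ₛ yt) n k ⟩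
  (oneₛ *ₛ (oneₛ +ₛ yt)) n k + (t *ₛ (oneₛ +ₛ yt)) n k
    ≡⟨ cong₂ _+_ (*ₛ-identityˡ (oneₛ +ₛ yt) n k) (*ₛ-distribˡ-+ₛ oneₛ yt t n k) ⟩
  (oneₛ n k + yt n k) + ((t *ₛ oneₛ) n k + (t *ₛ yt) n k)
    ≡⟨ cong (λ z → (oneₛ n k + yt n k) + (z + (t *ₛ yt) n k)) (*ₛ-identityʳ t n k) ⟩
  (oneₛ n k + yt n k) + (t n k + (t *ₛ yt) n k) ∎
  where
  yt = yₛ *ₛ t

*ₛ-yₛ-*ₛ : ∀ f g n k → (f *ₛ (yₛ *ₛ g)) n k ≡ shift ((f *ₛ g) n) k
*ₛ-yₛ-*ₛ f g n zero = begin
  (f *ₛ (yₛ *ₛ g)) n 0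
    ≡⟨ coeff-*ₛ f (yₛ *ₛ g) n 0 ⟩
  ∑[ i < suc n ] (f i 0 * (yₛ *ₛ g) (n ∸ i) 0 + + 0)
    ≡⟨ ∑-vanishing (suc n) (λ i → f i 0 * (yₛ *ₛ g) (n ∸ i) 0 + + 0) (λ i _ →
         trans (ℤP.+-identityʳ _) (trans (cong (f i 0 *_) (yₛ-*ₛ g (n ∸ i) 0)) (ℤP.*-zeroʳ (f i 0)))) ⟩
  + 0 ∎
*ₛ-yₛ-*ₛ f g n (suc k) = begin
  (f *ₛ (yₛ *ₛ g)) n (suc k)
    ≡⟨ coeff-*ₛ f (yₛ *ₛ g) n (suc k) ⟩
  ∑[ i < suc n ] ∑[ j < suc (suc k) ] (f i j * (yₛ *ₛ g) (n ∸ i) (suc k ∸ j))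
    ≡⟨ ∑-cong (suc n) column ⟩
  ∑[ i < suc n ] ∑[ j < suc k ] (f i j * g (n ∸ i) (k ∸ j))
    ≡⟨ sym (coeff-*ₛ f g n k) ⟩
  (f *ₛ g) n k ∎
  where
  column : ∀ i → ∑[ j < suc (suc k) ] (f i j * (yₛ *ₛ g) (n ∸ i) (suc k ∸ j))
                 ≡ ∑[ j < suc k ] (f i j * g (n ∸ i) (k ∸ j))
  column i = begin
    ∑[ j < suc (suc k) ] (f i j * (yₛ *ₛ g) (n ∸ i) (suc k ∸ j))
      ≡⟨ ∑-last (suc k) (λ j → f i j * (yₛ *ₛ g) (n ∸ i) (suc k ∸ j)) ⟩
    (∑[ j < suc k ] (f i j * (yₛ *ₛ g) (n ∸ i) (suc k ∸ j))) + f i (suc k) * (yₛ *ₛ g) (n ∸ i) (k ∸ k)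
      ≡⟨ cong₂ _+_
           (∑-cong< (suc k) (λ j j≤k → cong (f i j *_)
              (trans (yₛ-*ₛ g (n ∸ i) (suc k ∸ j)) (cong (shift (g (n ∸ i))) (suc∸ (ℕP.≤-pred j≤k))))))
           (trans (cong (λ z → f i (suc k) * (yₛ *ₛ g) (n ∸ i) z) (ℕP.n∸n≡0 k))
                  (trans (cong (f i (suc k) *_) (yₛ-*ₛ g (n ∸ i) 0)) (ℤP.*-zeroʳ (f i (suc k))))) ⟩
    (∑[ j < suc k ] (f i j * g (n ∸ i) (k ∸ j))) + + 0
      ≡⟨ ℤP.+-identityʳ _ ⟩
    ∑[ j < suc k ] (f i j * g (n ∸ i) (k ∸ j)) ∎

wₛ-*ₛ-*ₛ-zero : ∀ f g k → ((wₛ *ₛ f) *ₛ g) 0 k ≡ + 0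
wₛ-*ₛ-*ₛ-zero f g k = trans (coeff-*ₛ (wₛ *ₛ f) g 0 k) (trans (ℤP.+-identityʳ _)
  (∑-vanishing (suc k) (λ j → (wₛ *ₛ f) 0 j * g 0 (k ∸ j))
     (λ j _ → trans (cong (_* g 0 (k ∸ j)) (wₛ-*ₛ-zero f j)) (ℤP.*-zeroˡ (g 0 (k ∸ j))))))

wₛ-*ₛ-*ₛ-suc : ∀ f g n k → ((wₛ *ₛ f) *ₛ g) (suc n) k ≡ (f *ₛ g) n k
wₛ-*ₛ-*ₛ-suc f g n k = begin
  ((wₛ *ₛ f) *ₛ g) (suc n) k
    ≡⟨ coeff-*ₛ (wₛ *ₛ f) g (suc n) k ⟩
  (∑[ j < suc k ] ((wₛ *ₛ f) 0 j * g (suc n) (k ∸ j)))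
    + (∑[ i < suc n ] ∑[ j < suc k ] ((wₛ *ₛ f) (suc i) j * g (n ∸ i) (k ∸ j)))
    ≡⟨ cong₂ _+_
         (∑-vanishing (suc k) (λ j → (wₛ *ₛ f) 0 j * g (suc n) (k ∸ j))
            (λ j _ → trans (cong (_* g (suc n) (k ∸ j)) (wₛ-*ₛ-zero f j)) (ℤP.*-zeroˡ (g (suc n) (k ∸ j)))))
         (∑-cong (suc n) (λ i → ∑-cong (suc k) (λ j → cong (_* g (n ∸ i) (k ∸ j)) (wₛ-*ₛ-suc f i j)))) ⟩
  + 0 + (∑[ i < suc n ] ∑[ j < suc k ] (f i j * g (n ∸ i) (k ∸ j)))
    ≡⟨ trans (ℤP.+-identityˡ _) (sym (coeff-*ₛ f g n k)) ⟩
  (f *ₛ g) n k ∎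

*ₛ-wₛ-*ₛ-zero : ∀ f g k → (f *ₛ (wₛ *ₛ g)) 0 k ≡ + 0
*ₛ-wₛ-*ₛ-zero f g k = trans (coeff-*ₛ f (wₛ *ₛ g) 0 k) (trans (ℤP.+-identityʳ _)
  (∑-vanishing (suc k) (λ j → f 0 j * (wₛ *ₛ g) 0 (k ∸ j))
     (λ j _ → trans (cong (f 0 j *_) (wₛ-*ₛ-zero g (k ∸ j))) (ℤP.*-zeroʳ (f 0 j)))))

*ₛ-wₛ-*ₛ-suc : ∀ f g n k → (f *ₛ (wₛ *ₛ g)) (suc n) k ≡ (f *ₛ g) n k
*ₛ-wₛ-*ₛ-suc f g n k = begin
  (f *ₛ (wₛ *ₛ g)) (suc n) k
    ≡⟨ coeff-*ₛ f (wₛ *ₛ g) (suc n) k ⟩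
  ∑[ i < suc (suc n) ] ∑[ j < suc k ] (f i j * (wₛ *ₛ g) (suc n ∸ i) (k ∸ j))
    ≡⟨ ∑-last (suc n) (λ i → ∑[ j < suc k ] (f i j * (wₛ *ₛ g) (suc n ∸ i) (k ∸ j))) ⟩
  (∑[ i < suc n ] ∑[ j < suc k ] (f i j * (wₛ *ₛ g) (suc n ∸ i) (k ∸ j)))
    + (∑[ j < suc k ] (f (suc n) j * (wₛ *ₛ g) (n ∸ n) (k ∸ j)))
    ≡⟨ cong₂ _+_
         (∑-cong< (suc n) (λ i i≤n → ∑-cong (suc k) (λ j → cong (f i j *_)
            (trans (cong (λ z → (wₛ *ₛ g) z (k ∸ j)) (suc∸ (ℕP.≤-pred i≤n))) (wₛ-*ₛ-suc g (n ∸ i) (k ∸ j))))))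
         (∑-vanishing (suc k) (λ j → f (suc n) j * (wₛ *ₛ g) (n ∸ n) (k ∸ j)) (λ j _ →
            trans (cong (λ z → f (suc n) j * (wₛ *ₛ g) z (k ∸ j)) (ℕP.n∸n≡0 n))
                  (trans (cong (f (suc n) j *_) (wₛ-*ₛ-zero g (k ∸ j))) (ℤP.*-zeroʳ (f (suc n) j))))) ⟩
  (∑[ i < suc n ] ∑[ j < suc k ] (f i j * g (n ∸ i) (k ∸ j))) + + 0
    ≡⟨ trans (ℤP.+-identityʳ _) (sym (coeff-*ₛ f g n k)) ⟩
  (f *ₛ g) n k ∎

-- The counting table and its quadratic equation

conv : (ℕ → ℤ) → (ℕ → ℤ) → ℕ → ℤ
conv a b k = ∑[ j < suc k ] (a j * b (k ∸ j))

conv-+ˡ : ∀ (f g b : ℕ → ℤ) k → conv (λ j → f j + g j) b k ≡ conv f b k + conv g b k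
conv-+ˡ f g b k = trans (∑-cong (suc k) (λ j → ℤP.*-distribʳ-+ (b (k ∸ j)) (f j) (g j)))
                       (∑-distrib-+ (suc k) (λ j → f j * b (k ∸ j)) (λ j → g j * b (k ∸ j)))

conv-shiftˡ : ∀ (f b : ℕ → ℤ) k → conv (shift f) b k ≡ shift (conv f b) k
conv-shiftˡ f b zero    = ℤP.*-zeroˡ (b 0)
conv-shiftˡ f b (suc k) =
  trans (cong (_+ conv f b k) (ℤP.*-zeroˡ (b (suc k)))) (ℤP.+-identityˡ (conv f b k))

conv-∑ˡ : ∀ m (F : ℕ → ℕ → ℤ) b k → conv (λ j → ∑[ l < m ] F l j) b k ≡ ∑[ l < m ] conv (F l) b k
conv-∑ˡ m F b k = trans (∑-cong (suc k) (λ j → *-distribʳ-∑ m (b (k ∸ j)) (λ l → F l j)))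
                        (∑-comm (suc k) m (λ j l → F l j * b (k ∸ j)))

-- The number of ways to put n more rows on a tableau of weight 1 whose
-- columns have m topmost labels β, gaining k new •'s.
ways : ℕ → ℕ → ℕ → ℤ
ways zero    m zero    = + 1
ways zero    m (suc k) = + 0
ways (suc n) m k       = ways n (suc m) k + shift (λ k′ → ∑[ j < suc m ] ways n j k′) k

conv-ways-zero : ∀ m b k → conv (ways 0 m) b k ≡ b k
conv-ways-zero m b k =
  trans (∑-only-head k (λ j → ways 0 m j * b (k ∸ j)) (λ i → ℤP.*-zeroˡ (b (k ∸ suc i))))
        (ℤP.*-identityˡ (b k))

-- The wⁿ⁻¹-coefficient of P_m · P_0, where P_m = Σₙ ways n m · wⁿ.
waysProd : ℕ → ℕ → ℕ → ℤ
waysProd n m k = ∑[ a < n ] conv (ways a m) (ways (n ∸ suc a) 0) k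

-- The three identities say P_{m+1} = P_m · (1 + y w P_0), proved
-- coefficientwise by a joint induction on the w-degree.
mutual
  ways-sucᵐ : ∀ n m k → ways n (suc m) k ≡ ways n m k + shift (waysProd n m) k
  ways-sucᵐ zero    m zero    = refl
  ways-sucᵐ zero    m (suc k) = refl
  ways-sucᵐ (suc n) m k = begin
    ways n (suc (suc m)) k + shift (λ x → ∑< (suc (suc m)) (λ j → ways n j x)) k
      ≡⟨ cong₂ _+_ (ways-sucᵐ n (suc m) k) (shift-cong (λ x → ∑-last (suc m) (λ j → ways n j x)) k) ⟩
    (ways n (suc m) k + shift (waysProd n (suc m)) k) + shift (λ x → Σm x + ways n (suc m) x) k
      ≡⟨ cong (_+_ (ways n (suc m) k + shift (waysProd n (suc m)) k)) (shift-+ Σm (ways n (suc m)) k) ⟩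
    (ways n (suc m) k + shift (waysProd n (suc m)) k) + (shift Σm k + shift (ways n (suc m)) k)
      ≡⟨ interchange (ways n (suc m) k) (shift (waysProd n (suc m)) k) (shift Σm k) (shift (ways n (suc m)) k) ⟩
    (ways n (suc m) k + shift Σm k) + (shift (waysProd n (suc m)) k + shift (ways n (suc m)) k)
      ≡⟨ cong (_+_ (ways n (suc m) k + shift Σm k)) (sym (shift-+ (waysProd n (suc m)) (ways n (suc m)) k)) ⟩
    (ways n (suc m) k + shift Σm k) + shift (λ x → waysProd n (suc m) x + ways n (suc m) x) k
      ≡⟨ cong (_+_ (ways n (suc m) k + shift Σm k)) (shift-cong (λ x → sym (waysProd-sucⁿ n m x)) k) ⟩
    (ways n (suc m) k + shift Σm k) + shift (waysProd (suc n) m) k ∎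
    where
    Σm : ℕ → ℤ
    Σm x = ∑[ j < suc m ] ways n j x

  ways-sucᵐ-from-zero : ∀ n m k →
    ways n (suc m) k ≡ ways n 0 k + shift (λ x → ∑[ l < suc m ] waysProd n l x) k
  ways-sucᵐ-from-zero n zero k =
    trans (ways-sucᵐ n 0 k) (cong (_+_ (ways n 0 k)) (shift-cong (λ x → sym (ℤP.+-identityʳ (waysProd n 0 x))) k))
  ways-sucᵐ-from-zero n (suc m) k = begin
    ways n (suc (suc m)) k
      ≡⟨ ways-sucᵐ n (suc m) k ⟩
    ways n (suc m) k + shift (waysProd n (suc m)) k
      ≡⟨ cong (_+ shift (waysProd n (suc m)) k) (ways-sucᵐ-from-zero n m k) ⟩
    ways n 0 k + shift Σm k + shift (waysProd n (suc m)) k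
      ≡⟨ ℤP.+-assoc (ways n 0 k) (shift Σm k) (shift (waysProd n (suc m)) k) ⟩
    ways n 0 k + (shift Σm k + shift (waysProd n (suc m)) k)
      ≡⟨ cong (_+_ (ways n 0 k)) (sym (shift-+ Σm (waysProd n (suc m)) k)) ⟩
    ways n 0 k + shift (λ x → Σm x + waysProd n (suc m) x) k
      ≡⟨ cong (_+_ (ways n 0 k)) (shift-cong (λ x → sym (∑-last (suc m) (λ l → waysProd n l x))) k) ⟩
    ways n 0 k + shift (λ x → ∑[ l < suc (suc m) ] waysProd n l x) k ∎
    where
    Σm : ℕ → ℤ
    Σm x = ∑[ l < suc m ] waysProd n l x

  waysProd-sucⁿ : ∀ n m x → waysProd (suc n) m x ≡ waysProd n (suc m) x + ways n (suc m) x
  waysProd-sucⁿ n m x = begin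
    conv (ways 0 m) (ways n 0) x + (∑[ a < n ] conv (ways (suc a) m) (Q a) x)
      ≡⟨ cong₂ _+_ (conv-ways-zero m (ways n 0) x)
                   (∑-cong n (λ a → conv-+ˡ (ways a (suc m)) (shift (F a)) (Q a) x)) ⟩
    ways n 0 x + (∑[ a < n ] (conv (ways a (suc m)) (Q a) x + conv (shift (F a)) (Q a) x))
      ≡⟨ cong (_+_ (ways n 0 x)) (∑-distrib-+ n (λ a → conv (ways a (suc m)) (Q a) x)
                                                (λ a → conv (shift (F a)) (Q a) x)) ⟩
    ways n 0 x + (waysProd n (suc m) x + (∑[ a < n ] conv (shift (F a)) (Q a) x))
      ≡⟨ cong (λ z → ways n 0 x + (waysProd n (suc m) x + z)) (∑-cong n (λ a →
           trans (conv-shiftˡ (F a) (Q a) x) (shift-cong (λ y → conv-∑ˡ (suc m) (ways a) (Q a) y) x))) ⟩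
    ways n 0 x + (waysProd n (suc m) x + (∑[ a < n ] shift (λ y → ∑[ l < suc m ] conv (ways a l) (Q a) y) x))
      ≡⟨ cong (λ z → ways n 0 x + (waysProd n (suc m) x + z))
              (sym (shift-∑ n (λ a y → ∑[ l < suc m ] conv (ways a l) (Q a) y) x)) ⟩
    ways n 0 x + (waysProd n (suc m) x + shift (λ y → ∑[ a < n ] ∑[ l < suc m ] conv (ways a l) (Q a) y) x)
      ≡⟨ cong (λ z → ways n 0 x + (waysProd n (suc m) x + z))
              (shift-cong (λ y → ∑-comm n (suc m) (λ a l → conv (ways a l) (Q a) y)) x) ⟩
    ways n 0 x + (waysProd n (suc m) x + shift (λ y → ∑[ l < suc m ] waysProd n l y) x)
      ≡⟨ x∙yz≈y∙xz (ways n 0 x) (waysProd n (suc m) x) _ ⟩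
    waysProd n (suc m) x + (ways n 0 x + shift (λ y → ∑[ l < suc m ] waysProd n l y) x)
      ≡⟨ cong (_+_ (waysProd n (suc m) x)) (sym (ways-sucᵐ-from-zero n m x)) ⟩
    waysProd n (suc m) x + ways n (suc m) x ∎
    where
    Q : ℕ → ℕ → ℤ
    Q a = ways (n ∸ suc a) 0
    F : ℕ → ℕ → ℤ
    F a k = ∑[ j < suc m ] ways a j k

ways₀ : Series
ways₀ n k = ways n 0 k

waysProd-zero : ∀ n k → waysProd n 0 k ≡ (ways₀ *ₛ (wₛ *ₛ ways₀)) n k
waysProd-zero zero    k = sym (*ₛ-wₛ-*ₛ-zero ways₀ ways₀ k)
waysProd-zero (suc n) k = sym (trans (*ₛ-wₛ-*ₛ-suc ways₀ ways₀ n k) (coeff-*ₛ ways₀ ways₀ n k))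

ways₀-fixpoint : φ (wₛ *ₛ ways₀) ≈ₛ ways₀
ways₀-fixpoint zero k = begin
  φ t zero k
    ≡⟨ φ-expand t zero k ⟩
  (oneₛ 0 k + (yₛ *ₛ t) 0 k) + (t 0 k + (t *ₛ (yₛ *ₛ t)) 0 k)
    ≡⟨ cong₂ _+_ (cong (_+_ (oneₛ 0 k)) (trans (yₛ-*ₛ t 0 k) (shift-cong (wₛ-*ₛ-zero ways₀) k)))
                 (cong₂ _+_ (wₛ-*ₛ-zero ways₀ k) (wₛ-*ₛ-*ₛ-zero ways₀ (yₛ *ₛ t) k)) ⟩
  (oneₛ 0 k + shift (λ _ → + 0) k) + (+ 0 + + 0)
    ≡⟨ constant-term k ⟩
  ways₀ 0 k ∎
  where
  t = wₛ *ₛ ways₀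
  constant-term : ∀ k → (oneₛ 0 k + shift (λ _ → + 0) k) + (+ 0 + + 0) ≡ ways₀ 0 k
  constant-term zero    = refl
  constant-term (suc k) = refl
ways₀-fixpoint (suc n) k = begin
  φ t (suc n) k
    ≡⟨ φ-expand t (suc n) k ⟩
  (+ 0 + (yₛ *ₛ t) (suc n) k) + (t (suc n) k + (t *ₛ (yₛ *ₛ t)) (suc n) k)
    ≡⟨ cong₂ _+_ (cong (_+_ (+ 0)) (trans (yₛ-*ₛ t (suc n) k) (shift-cong (wₛ-*ₛ-suc ways₀ n) k)))
                 (cong₂ _+_ (wₛ-*ₛ-suc ways₀ n k) tyt) ⟩
  (+ 0 + shift (ways₀ n) k) + (ways₀ n k + shift (waysProd n 0) k)
    ≡⟨ rearrange (shift (ways₀ n) k) (ways₀ n k) (shift (waysProd n 0) k) ⟩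
  (ways₀ n k + shift (waysProd n 0) k) + shift (ways₀ n) k
    ≡⟨ cong₂ _+_ (sym (ways-sucᵐ n 0 k)) (shift-cong (λ x → sym (ℤP.+-identityʳ (ways₀ n x))) k) ⟩
  ways₀ (suc n) k ∎
  where
  t = wₛ *ₛ ways₀
  tyt : (t *ₛ (yₛ *ₛ t)) (suc n) k ≡ shift (waysProd n 0) k
  tyt = begin
    (t *ₛ (yₛ *ₛ t)) (suc n) k ≡⟨ wₛ-*ₛ-*ₛ-suc ways₀ (yₛ *ₛ t) n k ⟩
    (ways₀ *ₛ (yₛ *ₛ t)) n k   ≡⟨ *ₛ-yₛ-*ₛ ways₀ t n k ⟩
    shift ((ways₀ *ₛ t) n) k   ≡⟨ shift-cong (λ x → sym (waysProd-zero n x)) k ⟩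
    shift (waysProd n 0) k     ∎
  rearrange : ∀ a b c → (+ 0 + a) + (b + c) ≡ (b + c) + a
  rearrange = solve-∀

-- t agrees with w · ways₀ up to every degree: both are fixed by t ↦ w φ(t),
-- whose coefficient of wⁿ⁺¹ only depends on coefficients of degree ≤ n.
IsT-agrees-≤ : ∀ t → IsT t → ∀ n → t ≈[≤ n ] (wₛ *ₛ ways₀)
IsT-agrees-≤ t (t₀≡0 , fixed) zero zero k z≤n = trans (t₀≡0 k) (sym (wₛ-*ₛ-zero ways₀ k))
IsT-agrees-≤ t isT@(t₀≡0 , fixed) (suc n) i k i≤n with ℕP.m≤n⇒m<n∨m≡n i≤n
... | inj₁ i<n  = IsT-agrees-≤ t isT n i k (ℕP.≤-pred i<n)
... | inj₂ refl = begin
  t (suc n) k                    ≡⟨ sym (fixed (suc n) k) ⟩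
  (wₛ *ₛ φ t) (suc n) k          ≡⟨ wₛ-*ₛ-suc (φ t) n k ⟩
  φ t n k                        ≡⟨ φ-cong-≤ n (IsT-agrees-≤ t isT n) n k ℕP.≤-refl ⟩
  φ (wₛ *ₛ ways₀) n k            ≡⟨ ways₀-fixpoint n k ⟩
  ways₀ n k                      ≡⟨ sym (wₛ-*ₛ-suc ways₀ n k) ⟩
  (wₛ *ₛ ways₀) (suc n) k        ∎

ways₀≈φ : ∀ t → IsT t → ways₀ ≈ₛ φ t
ways₀≈φ t isT n k = trans (sym (ways₀-fixpoint n k))
  (φ-cong-≤ n (λ i j i≤n → sym (IsT-agrees-≤ t isT n i j i≤n)) n k ℕP.≤-refl)

w·ways₀-isT : IsT (wₛ *ₛ ways₀)
w·ways₀-isT = wₛ-*ₛ-zero ways₀ , fixed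
  where
  fixed : (wₛ *ₛ φ (wₛ *ₛ ways₀)) ≈ₛ (wₛ *ₛ ways₀)
  fixed zero    k = trans (wₛ-*ₛ-zero (φ (wₛ *ₛ ways₀)) k) (sym (wₛ-*ₛ-zero ways₀ k))
  fixed (suc n) k = trans (wₛ-*ₛ-suc (φ (wₛ *ₛ ways₀)) n k) (trans (ways₀-fixpoint n k) (sym (wₛ-*ₛ-suc ways₀ n k)))

-- Sums over lists

∑∈ : {A : Set} → List A → (A → ℤ) → ℤ
∑∈ xs f = sumℤ (map f xs)

infix 5 ∑∈
syntax ∑∈ xs (λ x → e) = ∑[ x ∈ xs ] e

∑∈-++ : {A : Set} (xs ys : List A) (f : A → ℤ) → ∑∈ (xs ++ ys) f ≡ ∑∈ xs f + ∑∈ ys f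
∑∈-++ []       ys f = sym (ℤP.+-identityˡ _)
∑∈-++ (x ∷ xs) ys f = trans (cong (_+_ (f x)) (∑∈-++ xs ys f)) (sym (ℤP.+-assoc (f x) _ _))

∑∈-concatMap : {A B : Set} (g : A → List B) (xs : List A) (f : B → ℤ) →
               ∑∈ (concatMap g xs) f ≡ ∑[ x ∈ xs ] ∑∈ (g x) f
∑∈-concatMap g []       f = refl
∑∈-concatMap g (x ∷ xs) f =
  trans (∑∈-++ (g x) (concatMap g xs) f) (cong (_+_ (∑∈ (g x) f)) (∑∈-concatMap g xs f))

∑∈-map : {A B : Set} (h : A → B) (xs : List A) (f : B → ℤ) → ∑∈ (map h xs) f ≡ ∑∈ xs (f ∘ h)
∑∈-map h xs f = cong sumℤ (sym (LP.map-∘ xs))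

∑∈-congᴬ : {A : Set} {xs : List A} {f g : A → ℤ} → All (λ x → f x ≡ g x) xs → ∑∈ xs f ≡ ∑∈ xs g
∑∈-congᴬ []         = refl
∑∈-congᴬ (eq ∷ eqs) = cong₂ _+_ eq (∑∈-congᴬ eqs)

∑∈-cong : {A : Set} (xs : List A) {f g : A → ℤ} → (∀ x → f x ≡ g x) → ∑∈ xs f ≡ ∑∈ xs g
∑∈-cong xs eq = ∑∈-congᴬ (All.universal eq xs)

∑∈-distrib-+ : {A : Set} (xs : List A) (f g : A → ℤ) → ∑[ x ∈ xs ] (f x + g x) ≡ ∑∈ xs f + ∑∈ xs g
∑∈-distrib-+ []       f g = refl
∑∈-distrib-+ (x ∷ xs) f g = trans (cong (_+_ (f x + g x)) (∑∈-distrib-+ xs f g)) (interchange (f x) (g x) _ _)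

∑∈-zero : {A : Set} (xs : List A) → ∑[ x ∈ xs ] + 0 ≡ + 0
∑∈-zero []       = refl
∑∈-zero (x ∷ xs) = trans (ℤP.+-identityˡ _) (∑∈-zero xs)

∑∈-comm : {A B : Set} (xs : List A) (ys : List B) (F : A → B → ℤ) →
          ∑[ x ∈ xs ] ∑[ y ∈ ys ] F x y ≡ ∑[ y ∈ ys ] ∑[ x ∈ xs ] F x y
∑∈-comm []       ys F = sym (∑∈-zero ys)
∑∈-comm (x ∷ xs) ys F =
  trans (cong (_+_ (∑∈ ys (F x))) (∑∈-comm xs ys F)) (sym (∑∈-distrib-+ ys (F x) (λ y → ∑[ x ∈ xs ] F x y)))

∑∈-concatMap-∷ : {A : Set} (xs : List A) (yss : List (List A)) (f : List A → ℤ) →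
                 ∑∈ (concatMap (λ x → map (x ∷_) yss) xs) f ≡ ∑[ ys ∈ yss ] ∑[ x ∈ xs ] f (x ∷ ys)
∑∈-concatMap-∷ xs yss f = begin
  ∑∈ (concatMap (λ x → map (x ∷_) yss) xs) f     ≡⟨ ∑∈-concatMap (λ x → map (x ∷_) yss) xs f ⟩
  ∑[ x ∈ xs ] ∑∈ (map (x ∷_) yss) f              ≡⟨ ∑∈-cong xs (λ x → ∑∈-map (x ∷_) yss f) ⟩
  ∑[ x ∈ xs ] ∑[ ys ∈ yss ] f (x ∷ ys)           ≡⟨ ∑∈-comm xs yss (λ x ys → f (x ∷ ys)) ⟩
  ∑[ ys ∈ yss ] ∑[ x ∈ xs ] f (x ∷ ys)           ∎

*-distribˡ-∑∈ : {A : Set} (xs : List A) (c : ℤ) (f : A → ℤ) → c * ∑∈ xs f ≡ ∑[ x ∈ xs ] (c * f x)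
*-distribˡ-∑∈ []       c f = ℤP.*-zeroʳ c
*-distribˡ-∑∈ (x ∷ xs) c f = trans (ℤP.*-distribˡ-+ c (f x) _) (cong (_+_ (c * f x)) (*-distribˡ-∑∈ xs c f))

infixr 8 [_]·_
[_]·_ : Bool → ℤ → ℤ
[ b ]· x = if b then x else + 0

∑∈-[]· : {A : Set} (xs : List A) (b : Bool) (f : A → ℤ) → ∑[ x ∈ xs ] [ b ]· f x ≡ [ b ]· ∑∈ xs f
∑∈-[]· xs true  f = refl
∑∈-[]· xs false f = ∑∈-zero xs

sumℤ-filter : {A : Set} {P : Pred A 0ℓ} (P? : Decidable P) (xs : List A) (f : A → ℤ) →
              ∑∈ (filter P? xs) f ≡ ∑[ x ∈ xs ] [ does (P? x) ]· f x
sumℤ-filter P? []       f = refl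
sumℤ-filter P? (x ∷ xs) f with does (P? x)
... | true  = cong (_+_ (f x)) (sumℤ-filter P? xs f)
... | false = trans (sumℤ-filter P? xs f) (sym (ℤP.+-identityˡ _))

all< : ℕ → (ℕ → Bool) → Bool
all< zero    p = true
all< (suc n) p = p 0 ∧ all< n (p ∘ suc)

allB-applyUpTo : ∀ n (g : ℕ → ℕ) (p : ℕ → Bool) → allB (applyUpTo g n) p ≡ all< n (p ∘ g)
allB-applyUpTo zero    g p = refl
allB-applyUpTo (suc n) g p = cong (p (g 0) ∧_) (allB-applyUpTo n (g ∘ suc) p)

allB-upTo : ∀ n (p : ℕ → Bool) → allB (upTo n) p ≡ all< n p
allB-upTo n p = allB-applyUpTo n id p

all<-cong : ∀ n {p q : ℕ → Bool} → (∀ i → i < n → p i ≡ q i) → all< n p ≡ all< n q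
all<-cong zero    eq = refl
all<-cong (suc n) eq = cong₂ _∧_ (eq 0 (s≤s z≤n)) (all<-cong n (λ i i<n → eq (suc i) (s≤s i<n)))

∧≡true⇒ˡ : ∀ {a b} → a ∧ b ≡ true → a ≡ true
∧≡true⇒ˡ {true} _ = refl

∧≡true⇒ʳ : ∀ {a b} → a ∧ b ≡ true → b ≡ true
∧≡true⇒ʳ {true} h = h

all<-elim : ∀ n {p : ℕ → Bool} → all< n p ≡ true → ∀ i → i < n → p i ≡ true
all<-elim (suc n) {p} h zero    _         = ∧≡true⇒ˡ {p 0} h
all<-elim (suc n) {p} h (suc i) (s≤s i<n) = all<-elim n (∧≡true⇒ʳ {p 0} h) i i<n

all<-intro : ∀ n {p : ℕ → Bool} → (∀ i → i < n → p i ≡ true) → all< n p ≡ true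
all<-intro zero    h = refl
all<-intro (suc n) h =
  cong₂ _∧_ (h 0 (s≤s z≤n)) (all<-intro n (λ i i<n → h (suc i) (s≤s i<n)))

∧-interchange : ∀ a b c d → (a ∧ b) ∧ (c ∧ d) ≡ (a ∧ c) ∧ (b ∧ d)
∧-interchange = solve 4 (λ a b c d → (a :* b) :* (c :* d) := (a :* c) :* (b :* d)) refl
  where open ∨-∧-Solver

all<-∧ : ∀ n (p q : ℕ → Bool) → all< n (λ i → p i ∧ q i) ≡ all< n p ∧ all< n q
all<-∧ zero    p q = refl
all<-∧ (suc n) p q = trans (cong ((p 0 ∧ q 0) ∧_) (all<-∧ n (p ∘ suc) (q ∘ suc)))
                           (∧-interchange (p 0) (q 0) (all< n (p ∘ suc)) (all< n (q ∘ suc)))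

∏< : ℕ → (ℕ → ℤ) → ℤ
∏< zero    f = + 1
∏< (suc n) f = f 0 * ∏< n (f ∘ suc)

∏<-cong : ∀ n {f g : ℕ → ℤ} → (∀ i → i < n → f i ≡ g i) → ∏< n f ≡ ∏< n g
∏<-cong zero    eq = refl
∏<-cong (suc n) eq = cong₂ _*_ (eq 0 (s≤s z≤n)) (∏<-cong n (λ i i<n → eq (suc i) (s≤s i<n)))

prodℤ-++ : (xs ys : List ℤ) → prodℤ (xs ++ ys) ≡ prodℤ xs * prodℤ ys
prodℤ-++ []       ys = sym (ℤP.*-identityˡ _)
prodℤ-++ (x ∷ xs) ys = trans (cong (x *_) (prodℤ-++ xs ys)) (sym (ℤP.*-assoc x _ _))

prodℤ-map-applyUpTo : ∀ n (g : ℕ → ℕ) (f : ℕ → ℤ) → prodℤ (map f (applyUpTo g n)) ≡ ∏< n (f ∘ g)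
prodℤ-map-applyUpTo zero    g f = refl
prodℤ-map-applyUpTo (suc n) g f = cong (f (g 0) *_) (prodℤ-map-applyUpTo n (g ∘ suc) f)

prodℤ-concatMap-applyUpTo : ∀ n (g : ℕ → ℕ) (h : ℕ → List ℤ) →
  prodℤ (concatMap h (applyUpTo g n)) ≡ ∏< n (prodℤ ∘ h ∘ g)
prodℤ-concatMap-applyUpTo zero    g h = refl
prodℤ-concatMap-applyUpTo (suc n) g h =
  trans (prodℤ-++ (h (g 0)) _) (cong (prodℤ (h (g 0)) *_) (prodℤ-concatMap-applyUpTo n (g ∘ suc) h))

∨-elim-not : ∀ {a b} → not a ∨ b ≡ true → a ≡ true → b ≡ true
∨-elim-not {true} h refl = h

∨-intro-not : ∀ {a b} → (a ≡ true → b ≡ true) → not a ∨ b ≡ true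
∨-intro-not {true}  h = h refl
∨-intro-not {false} h = refl

-- Rows

open Weight (+ 1) (+ 1) (+ 0) (+ 0) (+ 0)

cellAt : List Cell → ℕ → Cell
cellAt = nth nothing

headCell : List Cell → Cell
headCell w = cellAt w 0

cellWt : Cell → Cell → Cell → ℤ
cellWt (just l) r b = labelWt l
cellWt nothing  r b = emptyWt r b

-- In the functions below p is the profile of the rows underneath: its
-- c-th entry is the label an empty box in column c sees below it.
rowWt : List Cell → List Cell → ℤ
rowWt []      p = + 1
rowWt (x ∷ w) p = cellWt x (firstJust w) (headCell p) * rowWt w (drop 1 p)

topmost : List Cell → List Cell → List Cell
topmost []      p = []
topmost (x ∷ w) p = (x <∣> headCell p) ∷ topmost w (drop 1 p)

columnsOK : List Cell → List Cell → Bool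
columnsOK []      p = true
columnsOK (x ∷ w) p = (not (isαγ (headCell p)) ∨ isEmpty x) ∧ columnsOK w (drop 1 p)

noβδ : List Cell → Bool
noβδ []      = true
noβδ (x ∷ w) = not (isβδ x) ∧ noβδ w

rowOK : List Cell → Bool
rowOK []           = true
rowOK (nothing ∷ w) = rowOK w
rowOK (just _ ∷ w)  = noβδ w

diagonal : List Cell → Cell
diagonal []          = nothing
diagonal (x ∷ [])    = x
diagonal (x ∷ y ∷ w) = diagonal (y ∷ w)

rowFits : List Cell → List Cell → Bool
rowFits w p = (not (isEmpty (diagonal w)) ∧ rowOK w) ∧ columnsOK w p

rowOK-∧-noβδ : ∀ w → rowOK w ∧ noβδ w ≡ noβδ w
rowOK-∧-noβδ []            = refl
rowOK-∧-noβδ (nothing ∷ w) = rowOK-∧-noβδ w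
rowOK-∧-noβδ (just α ∷ w)  = BP.∧-idem (noβδ w)
rowOK-∧-noβδ (just β ∷ w)  = BP.∧-zeroʳ (noβδ w)
rowOK-∧-noβδ (just γ ∷ w)  = BP.∧-idem (noβδ w)
rowOK-∧-noβδ (just δ ∷ w)  = BP.∧-zeroʳ (noβδ w)

rowOK-∷ : ∀ x w → rowOK (x ∷ w) ≡ rowOK w ∧ (isEmpty x ∨ noβδ w)
rowOK-∷ nothing  w = sym (BP.∧-identityʳ (rowOK w))
rowOK-∷ (just l) w = sym (rowOK-∧-noβδ w)

rowFits-∷ : ∀ x y w p₀ p → rowFits (x ∷ y ∷ w) (p₀ ∷ p)
            ≡ rowFits (y ∷ w) p ∧ ((isEmpty x ∨ noβδ (y ∷ w)) ∧ (not (isαγ p₀) ∨ isEmpty x))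
rowFits-∷ x y w p₀ p =
  trans (cong (λ b → (not (isEmpty (diagonal (y ∷ w))) ∧ b) ∧ ((not (isαγ p₀) ∨ isEmpty x) ∧ columnsOK (y ∷ w) p))
              (rowOK-∷ x (y ∷ w)))
        (rearrange (not (isEmpty (diagonal (y ∷ w)))) (rowOK (y ∷ w)) (isEmpty x ∨ noβδ (y ∷ w))
                   (not (isαγ p₀) ∨ isEmpty x) (columnsOK (y ∷ w) p))
  where
  open ∨-∧-Solver
  rearrange : ∀ d r e a c → (d ∧ (r ∧ e)) ∧ (a ∧ c) ≡ ((d ∧ r) ∧ c) ∧ (e ∧ a)
  rearrange = solve 5 (λ d r e a c → (d :* (r :* e)) :* (a :* c) := ((d :* r) :* c) :* (e :* a)) refl

cellAt-suc : ∀ p c → cellAt p (suc c) ≡ cellAt (drop 1 p) c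
cellAt-suc []      c = refl
cellAt-suc (x ∷ p) c = refl

applyUpTo-cong : ∀ {A : Set} m {f g : ℕ → A} → (∀ i → i < m → f i ≡ g i) → applyUpTo f m ≡ applyUpTo g m
applyUpTo-cong zero    eq = refl
applyUpTo-cong (suc m) eq = cong₂ _∷_ (eq 0 (s≤s z≤n)) (applyUpTo-cong m (λ i i<m → eq (suc i) (s≤s i<m)))

diagonal-index : ∀ n w → length w ≡ suc n → cellAt w n ≡ diagonal w
diagonal-index zero    (x ∷ [])    refl = refl
diagonal-index (suc n) (x ∷ y ∷ w) eq   = diagonal-index n (y ∷ w) (ℕP.suc-injective eq)

diagonalFilled-index : ∀ n w → length w ≡ suc n →
  all< (suc n) (λ c → not (c ≡ᵇ n) ∨ not (isEmpty (cellAt w c))) ≡ not (isEmpty (diagonal w))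
diagonalFilled-index zero    (x ∷ [])    refl = BP.∧-identityʳ _
diagonalFilled-index (suc n) (x ∷ y ∷ w) eq   = diagonalFilled-index n (y ∷ w) (ℕP.suc-injective eq)

-- With e = false this is the condition for a row whose left part already
-- contains a label.
rowOK-index : ∀ e w → all< (length w) (λ c → not (isβδ (cellAt w c)) ∨ (e ∧ all< c (isEmpty ∘ cellAt w)))
                      ≡ (if e then rowOK w else noβδ w)
rowOK-index false []      = refl
rowOK-index true  []      = refl
rowOK-index false (x ∷ w) =
  cong₂ _∧_ (BP.∨-identityʳ (not (isβδ x))) (rowOK-index false w)
rowOK-index true  (x ∷ w) =
  trans (cong (_∧ all< (length w) (λ c → not (isβδ (cellAt w c)) ∨ (isEmpty x ∧ all< c (isEmpty ∘ cellAt w))))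
              (BP.∨-zeroʳ (not (isβδ x))))
        (trans (rowOK-index (isEmpty x) w) (unfold x))
  where
  unfold : ∀ x → (if isEmpty x then rowOK w else noβδ w) ≡ rowOK (x ∷ w)
  unfold nothing  = refl
  unfold (just l) = refl

columnsOK-index : ∀ m w p → length w ≡ m →
  all< m (λ c → not (isαγ (cellAt p c)) ∨ isEmpty (cellAt w c)) ≡ columnsOK w p
columnsOK-index zero    []      p refl = refl
columnsOK-index (suc m) (x ∷ w) p eq   = cong ((not (isαγ (headCell p)) ∨ isEmpty x) ∧_)
  (trans (all<-cong m (λ c _ → cong (λ z → not (isαγ z) ∨ isEmpty (cellAt w c)) (cellAt-suc p c)))
         (columnsOK-index m w (drop 1 p) (ℕP.suc-injective eq)))

rowWt-index : ∀ m w p → length w ≡ m →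
  ∏< m (λ c → cellWt (cellAt w c) (firstJust (drop (suc c) w)) (cellAt p c)) ≡ rowWt w p
rowWt-index zero    []      p refl = refl
rowWt-index (suc m) (x ∷ w) p eq   = cong (cellWt x (firstJust w) (headCell p) *_)
  (trans (∏<-cong m (λ c _ → cong (cellWt (cellAt w c) (firstJust (drop (suc c) w))) (cellAt-suc p c)))
         (rowWt-index m w (drop 1 p) (ℕP.suc-injective eq)))

topmost-index : ∀ m w p → length w ≡ m → applyUpTo (λ c → cellAt w c <∣> cellAt p c) m ≡ topmost w p
topmost-index zero    []      p refl = refl
topmost-index (suc m) (x ∷ w) p eq   = cong ((x <∣> headCell p) ∷_)
  (trans (applyUpTo-cong m (λ c _ → cong (cellAt w c <∣>_) (cellAt-suc p c)))
         (topmost-index m w (drop 1 p) (ℕP.suc-injective eq)))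

-- Tableaux as a top row on a smaller tableau

firstJust-∷ : ∀ x xs → firstJust (x ∷ xs) ≡ x <∣> firstJust xs
firstJust-∷ nothing  xs = refl
firstJust-∷ (just l) xs = refl

firstJust-none : ∀ n (f : ℕ → Cell) → (∀ r → r < n → f r ≡ nothing) → firstJust (applyUpTo f n) ≡ nothing
firstJust-none zero    f h = refl
firstJust-none (suc n) f h = trans (firstJust-∷ (f 0) _)
  (trans (cong (_<∣> firstJust (applyUpTo (f ∘ suc) n)) (h 0 (s≤s z≤n)))
         (firstJust-none n (f ∘ suc) (λ r r<n → h (suc r) (s≤s r<n))))

firstJust-first : ∀ n (f : ℕ → Cell) i l → (∀ r → r < i → f r ≡ nothing) → f i ≡ just l → i < n →
                  firstJust (applyUpTo f n) ≡ just l
firstJust-first (suc n) f zero    l h fi _ = trans (firstJust-∷ (f 0) _)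
  (cong (_<∣> firstJust (applyUpTo (f ∘ suc) n)) fi)
firstJust-first (suc n) f (suc i) l h fi (s≤s i<n) = trans (firstJust-∷ (f 0) _)
  (trans (cong (_<∣> firstJust (applyUpTo (f ∘ suc) n)) (h 0 (s≤s z≤n)))
         (firstJust-first n (f ∘ suc) i l (λ r r<i → h (suc r) (s≤s r<i)) fi i<n))

firstJust-witness : ∀ n (f : ℕ → Cell) l → firstJust (applyUpTo f n) ≡ just l → Σ ℕ (λ r → r < n × f r ≡ just l)
firstJust-witness (suc n) f l eq with f 0 in f0
... | just l′ = 0 , s≤s z≤n , trans f0 eq
... | nothing with firstJust-witness n (f ∘ suc) l eq
...   | r , r<n , fr = suc r , s≤s r<n , fr

cellAt-applyUpTo : ∀ (f : ℕ → Cell) n c → c < n → cellAt (applyUpTo f n) c ≡ f c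
cellAt-applyUpTo f (suc n) zero    _         = refl
cellAt-applyUpTo f (suc n) (suc c) (s≤s c<n) = cellAt-applyUpTo (f ∘ suc) n c c<n

cellAt-applyUpTo-beyond : ∀ (f : ℕ → Cell) n c → n ≤ c → cellAt (applyUpTo f n) c ≡ nothing
cellAt-applyUpTo-beyond f zero    c       _         = refl
cellAt-applyUpTo-beyond f (suc n) (suc c) (s≤s n≤c) = cellAt-applyUpTo-beyond (f ∘ suc) n c n≤c

cellAt-beyond : ∀ (w : List Cell) c → length w ≤ c → cellAt w c ≡ nothing
cellAt-beyond []      c       _         = refl
cellAt-beyond (x ∷ w) (suc c) (s≤s w≤c) = cellAt-beyond w c w≤c

topLabel : ℕ → Filling → ℕ → Cell
topLabel n T c = firstJust (applyUpTo (λ r → at T r c) n)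

profile : ℕ → Filling → List Cell
profile n T = applyUpTo (topLabel n T) n

InShape : ℕ → Filling → Set
InShape n T = ∀ r c → n ≤ r +ℕ c → at T r c ≡ nothing

InShape-∷ : ∀ n w T → length w ≡ suc n → InShape n T → InShape (suc n) (w ∷ T)
InShape-∷ n w T eq shaped zero    c n≤c       = cellAt-beyond w c (subst (_≤ c) (sym eq) n≤c)
InShape-∷ n w T eq shaped (suc r) c (s≤s n≤rc) = shaped r c n≤rc

topLabel≡profile : ∀ n T → InShape n T → ∀ c → c ≤ n → topLabel n T c ≡ cellAt (profile n T) c
topLabel≡profile n T shaped c c≤n with ℕP.m≤n⇒m<n∨m≡n c≤n
... | inj₁ c<n  = sym (cellAt-applyUpTo (topLabel n T) n c c<n)
... | inj₂ refl = trans (firstJust-none c (λ r → at T r c) (λ r _ → shaped r c (ℕP.m≤n+m c r)))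
                        (sym (cellAt-applyUpTo-beyond (topLabel c T) c c ℕP.≤-refl))

profile-∷ : ∀ n w T → InShape n T → length w ≡ suc n → profile (suc n) (w ∷ T) ≡ topmost w (profile n T)
profile-∷ n w T shaped eq = trans
  (applyUpTo-cong (suc n) (λ c c≤n → trans (firstJust-∷ (cellAt w c) (applyUpTo (λ r → at T r c) n))
     (cong (cellAt w c <∣>_) (topLabel≡profile n T shaped c (ℕP.≤-pred c≤n)))))
  (topmost-index (suc n) w (profile n T) eq)

words-length : ∀ m → All (λ w → length w ≡ m) (words m)
words-length zero    = refl ∷ []
words-length (suc m) = concat⁺ (map⁺ (All.universal (λ c → map⁺ {f = c ∷_} (All.map (cong suc) (words-length m))) cells))

allFillings-InShape : ∀ n → All (InShape n) (allFillings n)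
allFillings-InShape zero    = (λ r c _ → refl) ∷ []
allFillings-InShape (suc n) = concat⁺ (map⁺ (All.map
  (λ {w} eq → map⁺ {f = w ∷_} (All.map (InShape-∷ n w _ eq) (allFillings-InShape n)))
  (words-length (suc n))))

staircase : ℕ → Filling → Bool
staircase n T = all< n (λ r → all< (n ∸ r) (boxOK n T r))

isStaircase≡staircase : ∀ n T → isStaircase n T ≡ staircase n T
isStaircase≡staircase n T = trans (allB-upTo n _) (all<-cong n (λ r _ → allB-upTo (n ∸ r) _))

columnsClear : ℕ → List Cell → Filling → Bool
columnsClear n w T = all< n (λ r → all< (n ∸ r) (λ c → not (isαγ (at T r c)) ∨ isEmpty (cellAt w c)))

boxOK-∷ : ∀ n w T r c →
  boxOK (suc n) (w ∷ T) (suc r) c ≡ boxOK n T r c ∧ (not (isαγ (at T r c)) ∨ isEmpty (cellAt w c))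
boxOK-∷ n w T r c = trans
  (cong (λ b → diag ∧ βδ ∧ (not (isαγ (at T r c)) ∨ b))
        (trans (allB-upTo (suc r) (λ r′ → isEmpty (at (w ∷ T) r′ c)))
               (cong (isEmpty (cellAt w c) ∧_) (sym (allB-upTo r (λ r′ → isEmpty (at T r′ c)))))))
  (split diag βδ (isαγ (at T r c)) (isEmpty (cellAt w c)) (allB (upTo r) (λ r′ → isEmpty (at T r′ c))))
  where
  diag = not (isDiag n r c) ∨ not (isEmpty (at T r c))
  βδ   = not (isβδ (at T r c)) ∨ allB (upTo c) (λ c′ → isEmpty (at T r c′))
  split : ∀ d b x e a → d ∧ b ∧ (not x ∨ (e ∧ a)) ≡ (d ∧ b ∧ (not x ∨ a)) ∧ (not x ∨ e)
  split false b     x     e     a = refl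
  split true  false x     e     a = refl
  split true  true  false e     a = refl
  split true  true  true  false a = sym (BP.∧-zeroʳ a)
  split true  true  true  true  a = sym (BP.∧-identityʳ a)

isStaircase-∷ : ∀ n w T → isStaircase (suc n) (w ∷ T)
                ≡ all< (suc n) (boxOK (suc n) (w ∷ []) 0) ∧ (staircase n T ∧ columnsClear n w T)
isStaircase-∷ n w T = trans (isStaircase≡staircase (suc n) (w ∷ T))
  (cong (all< (suc n) (boxOK (suc n) (w ∷ []) 0) ∧_)
    (trans (all<-cong n (λ r _ → trans (all<-cong (n ∸ r) (λ c _ → boxOK-∷ n w T r c))
                                       (all<-∧ (n ∸ r) (boxOK n T r) (λ c → not (isαγ (at T r c)) ∨ isEmpty (cellAt w c)))))
           (all<-∧ n (λ r → all< (n ∸ r) (boxOK n T r))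
                     (λ r → all< (n ∸ r) (λ c → not (isαγ (at T r c)) ∨ isEmpty (cellAt w c))))))

topRow-index : ∀ n w → length w ≡ suc n →
  all< (suc n) (boxOK (suc n) (w ∷ []) 0) ≡ not (isEmpty (diagonal w)) ∧ rowOK w
topRow-index n w eq = begin
  all< (suc n) (λ c → diag c ∧ βδ c ∧ (not (isαγ (cellAt w c)) ∨ true))
    ≡⟨ all<-cong (suc n) (λ c _ → cong (λ b → diag c ∧ βδ c ∧ b) (BP.∨-zeroʳ (not (isαγ (cellAt w c))))) ⟩
  all< (suc n) (λ c → diag c ∧ βδ c ∧ true)
    ≡⟨ all<-cong (suc n) (λ c _ → cong (diag c ∧_) (BP.∧-identityʳ (βδ c))) ⟩
  all< (suc n) (λ c → diag c ∧ βδ c)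
    ≡⟨ all<-∧ (suc n) diag βδ ⟩
  all< (suc n) diag ∧ all< (suc n) βδ
    ≡⟨ cong₂ _∧_ (diagonalFilled-index n w eq)
         (trans (all<-cong (suc n) (λ c _ → cong (λ b → not (isβδ (cellAt w c)) ∨ b) (allB-upTo c (isEmpty ∘ cellAt w))))
                (subst (λ m → all< m (λ c → not (isβδ (cellAt w c)) ∨ all< c (isEmpty ∘ cellAt w)) ≡ rowOK w)
                       eq (rowOK-index true w))) ⟩
  not (isEmpty (diagonal w)) ∧ rowOK w ∎
  where
  diag βδ : ℕ → Bool
  diag c = not (c ≡ᵇ n) ∨ not (isEmpty (cellAt w c))
  βδ   c = not (isβδ (cellAt w c)) ∨ allB (upTo c) (isEmpty ∘ cellAt w)

isEmpty⇒nothing : ∀ {x} → isEmpty x ≡ true → x ≡ nothing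
isEmpty⇒nothing {nothing} _ = refl

isαγ⇒just : ∀ x → isαγ x ≡ true → Σ Label (λ l → x ≡ just l)
isαγ⇒just (just l) _ = l , refl

-- In a staircase tableau every α or γ is the topmost label of its column,
-- so the column condition only involves the profile.
columnsClear≡columnsOK : ∀ n T → staircase n T ≡ true → InShape n T → ∀ w → length w ≡ suc n →
                         columnsClear n w T ≡ columnsOK w (profile n T)
columnsClear≡columnsOK n T stair shaped w eq = begin
  columnsClear n w T
    ≡⟨ BP.⇔→≡ {z = true} (mk⇔ clear⇒ clear⇐) ⟩
  all< (suc n) (λ c → not (isαγ (topLabel n T c)) ∨ isEmpty (cellAt w c))
    ≡⟨ all<-cong (suc n) (λ c c≤n → cong (λ z → not (isαγ z) ∨ isEmpty (cellAt w c))
                                         (topLabel≡profile n T shaped c (ℕP.≤-pred c≤n))) ⟩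
  all< (suc n) (λ c → not (isαγ (cellAt (profile n T) c)) ∨ isEmpty (cellAt w c))
    ≡⟨ columnsOK-index (suc n) w (profile n T) eq ⟩
  columnsOK w (profile n T) ∎
  where
  clear⇒ : columnsClear n w T ≡ true → all< (suc n) (λ c → not (isαγ (topLabel n T c)) ∨ isEmpty (cellAt w c)) ≡ true
  clear⇒ h = all<-intro (suc n) (λ c _ → ∨-intro-not (λ αγ → column c αγ))
    where
    column : ∀ c → isαγ (topLabel n T c) ≡ true → isEmpty (cellAt w c) ≡ true
    column c αγ with isαγ⇒just (topLabel n T c) αγ
    ... | l , top with firstJust-witness n (λ r → at T r c) l top
    ...   | r , r<n , at≡l with (r +ℕ c) ℕP.<? n
    ...     | yes r+c<n = ∨-elim-not
                (all<-elim (n ∸ r) (all<-elim n h r r<n) c (ℕP.m+n≤o⇒m≤o∸n (suc c) (subst (_< n) (ℕP.+-comm r c) r+c<n)))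
                (trans (cong isαγ at≡l) (trans (cong isαγ (sym top)) αγ))
    ...     | no  r+c≮n with trans (sym (shaped r c (ℕP.≮⇒≥ r+c≮n))) at≡l
    ...       | ()
  clear⇐ : all< (suc n) (λ c → not (isαγ (topLabel n T c)) ∨ isEmpty (cellAt w c)) ≡ true → columnsClear n w T ≡ true
  clear⇐ h = all<-intro n (λ r r<n → all<-intro (n ∸ r) (λ c c<n∸r → ∨-intro-not (λ αγ → box r c r<n c<n∸r αγ)))
    where
    box : ∀ r c → r < n → c < n ∸ r → isαγ (at T r c) ≡ true → isEmpty (cellAt w c) ≡ true
    box r c r<n c<n∸r αγ with isαγ⇒just (at T r c) αγ
    ... | l , at≡l = ∨-elim-not
            (all<-elim (suc n) {λ c → not (isαγ (topLabel n T c)) ∨ isEmpty (cellAt w c)} h c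
                       (s≤s (ℕP.≤-trans (ℕP.<⇒≤ c<n∸r) (ℕP.m∸n≤m n r))))
            (trans (cong isαγ top) (trans (cong isαγ (sym at≡l)) αγ))
      where
      aboveEmpty : all< r (λ r′ → isEmpty (at T r′ c)) ≡ true
      aboveEmpty = trans (sym (allB-upTo r (λ r′ → isEmpty (at T r′ c))))
        (∨-elim-not (∧≡true⇒ʳ {not (isβδ (at T r c)) ∨ allB (upTo c) (λ c′ → isEmpty (at T r c′))}
                       (∧≡true⇒ʳ {not (isDiag n r c) ∨ not (isEmpty (at T r c))}
                          (all<-elim (n ∸ r) (all<-elim n stair r r<n) c c<n∸r)))
                    αγ)
      top : topLabel n T c ≡ just l
      top = firstJust-first n (λ r′ → at T r′ c) r l
              (λ r′ r′<r → isEmpty⇒nothing (all<-elim r aboveEmpty r′ r′<r)) at≡l r<n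

wt≡∏< : ∀ m T → wt m T ≡ ∏< m (λ r → ∏< (m ∸ r) (boxWt m T r))
wt≡∏< m T = trans (prodℤ-concatMap-applyUpTo m id (λ r → map (boxWt m T r) (upTo (m ∸ r))))
  (∏<-cong m (λ r _ → prodℤ-map-applyUpTo (m ∸ r) id (boxWt m T r)))

boxWt≡cellWt : ∀ m T r c → boxWt m T r c ≡ cellWt (at T r c) (rightOf T r c) (belowOf m T r c)
boxWt≡cellWt m T r c with at T r c
... | just l  = refl
... | nothing = refl

belowOf-top : ∀ n w T c → belowOf (suc n) (w ∷ T) 0 c ≡ topLabel n T c
belowOf-top n w T c = cong firstJust (LP.map-applyUpTo suc (λ r → at (w ∷ T) r c) n)

belowOf-∷ : ∀ n w T r c → belowOf (suc n) (w ∷ T) (suc r) c ≡ belowOf n T r c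
belowOf-∷ n w T r c = cong firstJust (begin
  map (λ r′ → at (w ∷ T) r′ c) (drop (suc r) (applyUpTo suc n))
    ≡⟨ cong (λ xs → map (λ r′ → at (w ∷ T) r′ c) (drop (suc r) xs)) (sym (LP.map-upTo suc n)) ⟩
  map (λ r′ → at (w ∷ T) r′ c) (drop (suc r) (map suc (upTo n)))
    ≡⟨ cong (map (λ r′ → at (w ∷ T) r′ c)) (LP.drop-map (suc r) (upTo n)) ⟩
  map (λ r′ → at (w ∷ T) r′ c) (map suc (drop (suc r) (upTo n)))
    ≡⟨ sym (LP.map-∘ (drop (suc r) (upTo n))) ⟩
  map (λ r′ → at T r′ c) (drop (suc r) (upTo n)) ∎)

wt-∷ : ∀ n w T → InShape n T → length w ≡ suc n → wt (suc n) (w ∷ T) ≡ rowWt w (profile n T) * wt n T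
wt-∷ n w T shaped eq = trans (wt≡∏< (suc n) (w ∷ T)) (cong₂ _*_ topRow lowerRows)
  where
  topRow : ∏< (suc n) (boxWt (suc n) (w ∷ T) 0) ≡ rowWt w (profile n T)
  topRow = trans
    (∏<-cong (suc n) (λ c c≤n → trans (boxWt≡cellWt (suc n) (w ∷ T) 0 c)
       (cong (cellWt (cellAt w c) (firstJust (drop (suc c) w)))
             (trans (belowOf-top n w T c) (topLabel≡profile n T shaped c (ℕP.≤-pred c≤n))))))
    (rowWt-index (suc n) w (profile n T) eq)
  lowerRows : ∏< n (λ r → ∏< (n ∸ r) (boxWt (suc n) (w ∷ T) (suc r))) ≡ wt n T
  lowerRows = trans
    (∏<-cong n (λ r _ → ∏<-cong (n ∸ r) (λ c _ →
       trans (boxWt≡cellWt (suc n) (w ∷ T) (suc r) c)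
             (trans (cong (cellWt (at T r c) (rightOf T r c)) (belowOf-∷ n w T r c))
                    (sym (boxWt≡cellWt n T r c))))))
    (sym (wt≡∏< n T))

count< : ℕ → (ℕ → Bool) → ℕ
count< zero    p = 0
count< (suc m) p = (if p 0 then 1 else 0) +ℕ count< m (p ∘ suc)

length-filter-applyUpTo : ∀ m (g : ℕ → ℕ) (p : ℕ → Bool) →
  length (filter (T? ∘ p) (applyUpTo g m)) ≡ count< m (p ∘ g)
length-filter-applyUpTo zero    g p = refl
length-filter-applyUpTo (suc m) g p with p (g 0)
... | true  = cong suc (length-filter-applyUpTo m (g ∘ suc) p)
... | false = length-filter-applyUpTo m (g ∘ suc) p

typeCount≡count< : ∀ m T → typeCount m T ≡ count< m (λ r → isαδ (at T r (m ∸ suc r)))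
typeCount≡count< m T = length-filter-applyUpTo m id (λ r → isαδ (at T r (m ∸ suc r)))

•? : Cell → ℕ
•? x = if isαδ x then 1 else 0

typeCount-∷ : ∀ n w T → typeCount (suc n) (w ∷ T) ≡ •? (cellAt w n) +ℕ typeCount n T
typeCount-∷ n w T =
  trans (typeCount≡count< (suc n) (w ∷ T)) (cong (•? (cellAt w n) +ℕ_) (sym (typeCount≡count< n T)))

weighted : ℕ → (List Cell → ℕ → ℤ) → ℤ
weighted n F = ∑[ T ∈ allFillings n ] [ isStaircase n T ]· (wt n T * F (profile n T) (typeCount n T))

rowContribution : (List Cell → ℕ → ℤ) → List Cell → ℕ → List Cell → ℤ
rowContribution F p t w = [ rowFits w p ]· (rowWt w p * F (topmost w p) (•? (diagonal w) +ℕ t))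

addRow : ℕ → (List Cell → ℕ → ℤ) → List Cell → ℕ → ℤ
addRow n F p t = ∑[ w ∈ words (suc n) ] rowContribution F p t w

[]·-pull : ∀ b (r W x : ℤ) → [ b ]· (r * W * x) ≡ W * [ b ]· (r * x)
[]·-pull true  r W x = rearrange r W x
  where
  rearrange : ∀ (r W x : ℤ) → r * W * x ≡ W * (r * x)
  rearrange = solve-∀
[]·-pull false r W x = sym (ℤP.*-zeroʳ W)

weighted-∷ : ∀ n F T → InShape n T → ∀ w → length w ≡ suc n →
  [ isStaircase (suc n) (w ∷ T) ]· (wt (suc n) (w ∷ T) * F (profile (suc n) (w ∷ T)) (typeCount (suc n) (w ∷ T)))
  ≡ [ isStaircase n T ]· (wt n T * rowContribution F (profile n T) (typeCount n T) w)
weighted-∷ n F T shaped w eq = begin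
  [ isStaircase (suc n) (w ∷ T) ]· (wt (suc n) (w ∷ T) * F (profile (suc n) (w ∷ T)) (typeCount (suc n) (w ∷ T)))
    ≡⟨ cong₂ [_]·_ (trans (isStaircase-∷ n w T) (cong (_∧ (staircase n T ∧ columnsClear n w T)) (topRow-index n w eq)))
                   (cong₂ _*_ (wt-∷ n w T shaped eq) (cong₂ F (profile-∷ n w T shaped eq) typeCount-w∷T)) ⟩
  [ rowBits ∧ (staircase n T ∧ columnsClear n w T) ]· (rowWt w p * wt n T * X)
    ≡⟨ split (staircase n T) refl ⟩
  [ staircase n T ]· (wt n T * rowContribution F p (typeCount n T) w)
    ≡⟨ cong (λ b → [ b ]· (wt n T * rowContribution F p (typeCount n T) w)) (sym (isStaircase≡staircase n T)) ⟩
  [ isStaircase n T ]· (wt n T * rowContribution F p (typeCount n T) w) ∎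
  where
  p = profile n T
  X = F (topmost w p) (•? (diagonal w) +ℕ typeCount n T)
  rowBits = not (isEmpty (diagonal w)) ∧ rowOK w
  typeCount-w∷T : typeCount (suc n) (w ∷ T) ≡ •? (diagonal w) +ℕ typeCount n T
  typeCount-w∷T = trans (typeCount-∷ n w T) (cong (λ x → •? x +ℕ typeCount n T) (diagonal-index n w eq))
  split : ∀ s → staircase n T ≡ s → [ rowBits ∧ (s ∧ columnsClear n w T) ]· (rowWt w p * wt n T * X)
                                    ≡ [ s ]· (wt n T * rowContribution F p (typeCount n T) w)
  split true  stair = trans (cong (λ b → [ rowBits ∧ b ]· (rowWt w p * wt n T * X))
                                  (columnsClear≡columnsOK n T stair shaped w eq))
                            ([]·-pull (rowFits w p) (rowWt w p) (wt n T) X)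
  split false _     = cong (λ b → [ b ]· (rowWt w p * wt n T * X)) (BP.∧-zeroʳ rowBits)

weighted-suc : ∀ n F → weighted (suc n) F ≡ weighted n (addRow n F)
weighted-suc n F = begin
  weighted (suc n) F
    ≡⟨ ∑∈-concatMap-∷ (words (suc n)) (allFillings n) summand ⟩
  ∑[ T ∈ allFillings n ] ∑[ w ∈ words (suc n) ] summand (w ∷ T)
    ≡⟨ ∑∈-congᴬ (All.map (λ {T} shaped → begin
         ∑[ w ∈ words (suc n) ] summand (w ∷ T)
           ≡⟨ ∑∈-congᴬ (All.map (λ {w} eq → weighted-∷ n F T shaped w eq) (words-length (suc n))) ⟩
         ∑[ w ∈ words (suc n) ] [ isStaircase n T ]· (wt n T * rowContribution F (profile n T) (typeCount n T) w)
           ≡⟨ ∑∈-[]· (words (suc n)) (isStaircase n T) (λ w → wt n T * rowContribution F (profile n T) (typeCount n T) w) ⟩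
         [ isStaircase n T ]· (∑[ w ∈ words (suc n) ] (wt n T * rowContribution F (profile n T) (typeCount n T) w))
           ≡⟨ cong [ isStaircase n T ]·_
                (sym (*-distribˡ-∑∈ (words (suc n)) (wt n T) (rowContribution F (profile n T) (typeCount n T)))) ⟩
         [ isStaircase n T ]· (wt n T * addRow n F (profile n T) (typeCount n T)) ∎)
       (allFillings-InShape n)) ⟩
  weighted n (addRow n F) ∎
  where
  summand : Filling → ℤ
  summand T = [ isStaircase (suc n) T ]· (wt (suc n) T * F (profile (suc n) T) (typeCount (suc n) T))

-- Summing over one row, cell by cell from the left

-- A function of what is remembered about the part of a row read so far:
-- its first label, whether it avoids β and δ, its new profile, and its
-- diagonal entry.
Observable : Set
Observable = Cell → Bool → List Cell → Cell → ℤ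

rowTerm : List Cell → Observable → List Cell → ℤ
rowTerm p χ w = [ rowFits w p ]· (rowWt w p * χ (firstJust w) (noβδ w) (topmost w p) (diagonal w))

rowSum : ℕ → List Cell → Observable → ℤ
rowSum m p χ = ∑[ w ∈ words (suc m) ] rowTerm p χ w

-- x is the new leftmost cell, above a column whose topmost label is p₀.
cellTerm : Cell → Observable → Cell → Bool → List Cell → Cell → Cell → ℤ
cellTerm p₀ χ f clean q d x = [ (isEmpty x ∨ clean) ∧ (not (isαγ p₀) ∨ isEmpty x) ]·
  (cellWt x f p₀ * χ (x <∣> f) (not (isβδ x) ∧ clean) ((x <∣> p₀) ∷ q) d)

extendLeft : Cell → Observable → Observable
extendLeft p₀ χ f clean q d = ∑[ x ∈ cells ] cellTerm p₀ χ f clean q d x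

[]·-∧ : ∀ a b (c r x : ℤ) → [ a ∧ b ]· (c * r * x) ≡ [ a ]· (r * [ b ]· (c * x))
[]·-∧ true  true  c r x = rearrange c r x
  where
  rearrange : ∀ (c r x : ℤ) → c * r * x ≡ r * (c * x)
  rearrange = solve-∀
[]·-∧ true  false c r x = sym (ℤP.*-zeroʳ r)
[]·-∧ false b     c r x = refl

rowTerm-∷ : ∀ p₀ p χ x y w → rowTerm (p₀ ∷ p) χ (x ∷ y ∷ w)
  ≡ [ rowFits (y ∷ w) p ]·
      (rowWt (y ∷ w) p * cellTerm p₀ χ (firstJust (y ∷ w)) (noβδ (y ∷ w)) (topmost (y ∷ w) p) (diagonal (y ∷ w)) x)
rowTerm-∷ p₀ p χ x y w = trans
  (cong₂ (λ b f → [ b ]· (cellWt x (firstJust (y ∷ w)) p₀ * rowWt (y ∷ w) p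
                           * χ f (not (isβδ x) ∧ noβδ (y ∷ w)) ((x <∣> p₀) ∷ topmost (y ∷ w) p) (diagonal (y ∷ w))))
         (rowFits-∷ x y w p₀ p) (firstJust-∷ x (y ∷ w)))
  ([]·-∧ (rowFits (y ∷ w) p) ((isEmpty x ∨ noβδ (y ∷ w)) ∧ (not (isαγ p₀) ∨ isEmpty x))
         (cellWt x (firstJust (y ∷ w)) p₀) (rowWt (y ∷ w) p)
         (χ (x <∣> firstJust (y ∷ w)) (not (isβδ x) ∧ noβδ (y ∷ w)) ((x <∣> p₀) ∷ topmost (y ∷ w) p) (diagonal (y ∷ w))))

rowSum-∷ : ∀ m p₀ p χ → rowSum (suc m) (p₀ ∷ p) χ ≡ rowSum m p (extendLeft p₀ χ)
rowSum-∷ m p₀ p χ = begin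
  rowSum (suc m) (p₀ ∷ p) χ
    ≡⟨ ∑∈-concatMap-∷ cells (words (suc m)) (rowTerm (p₀ ∷ p) χ) ⟩
  ∑[ w ∈ words (suc m) ] ∑[ x ∈ cells ] rowTerm (p₀ ∷ p) χ (x ∷ w)
    ≡⟨ ∑∈-congᴬ (All.map (λ {w} eq → peel w eq) (words-length (suc m))) ⟩
  rowSum m p (extendLeft p₀ χ) ∎
  where
  peel : ∀ w → length w ≡ suc m → ∑[ x ∈ cells ] rowTerm (p₀ ∷ p) χ (x ∷ w) ≡ rowTerm p (extendLeft p₀ χ) w
  peel (y ∷ w) _ = begin
    ∑[ x ∈ cells ] rowTerm (p₀ ∷ p) χ (x ∷ y ∷ w)
      ≡⟨ ∑∈-cong cells (λ x → rowTerm-∷ p₀ p χ x y w) ⟩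
    ∑[ x ∈ cells ] [ rowFits (y ∷ w) p ]· (rowWt (y ∷ w) p * c x)
      ≡⟨ ∑∈-[]· cells (rowFits (y ∷ w) p) (λ x → rowWt (y ∷ w) p * c x) ⟩
    [ rowFits (y ∷ w) p ]· (∑[ x ∈ cells ] (rowWt (y ∷ w) p * c x))
      ≡⟨ cong [ rowFits (y ∷ w) p ]·_ (sym (*-distribˡ-∑∈ cells (rowWt (y ∷ w) p) c)) ⟩
    rowTerm p (extendLeft p₀ χ) (y ∷ w) ∎
    where
    c = cellTerm p₀ χ (firstJust (y ∷ w)) (noβδ (y ∷ w)) (topmost (y ∷ w) p) (diagonal (y ∷ w))

record Summary : Set where
  constructor summary
  field
    first      : Cell
    clean      : Bool
    newProfile : List Cell
    diag       : Cell

observe : Observable → Summary → ℤ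
observe χ (summary f c q d) = χ f c q d

data IsAB : Cell → Set where
  α∈ : IsAB (just α)
  β∈ : IsAB (just β)

data Coherent : Summary → Set where
  from-α : ∀ {q d} → Coherent (summary (just α) true q d)
  from-β : ∀ {q d} → Coherent (summary (just β) false q d)

-- Over a profile in {α, β}* the rows of non-zero weight all have weight 1:
-- left of a β (which is then the first label) all boxes are empty, while
-- left of an α every box above a β must be labelled, and only one label β
-- may be chosen.
leftOfα : Cell → List Cell → Cell → List Summary
leftOfα (just β) q d = summary (just α) true (just α ∷ q) d ∷ summary (just β) false (just β ∷ q) d ∷ []
leftOfα p₀       q d = summary (just α) true (just α ∷ q) d ∷ []

extendSummary : Cell → Summary → List Summary
extendSummary p₀ (summary (just α) _ q d) = leftOfα p₀ q d
extendSummary p₀ (summary _ _ q d)        = summary (just β) false (p₀ ∷ q) d ∷ []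

rowSummaries : List Cell → List Summary
rowSummaries []      = summary (just α) true (just α ∷ []) (just α) ∷ summary (just β) false (just β ∷ []) (just β) ∷ []
rowSummaries (p₀ ∷ p) = concatMap (extendSummary p₀) (rowSummaries p)

extendSummary-coherent : ∀ p₀ o → All Coherent (extendSummary p₀ o)
extendSummary-coherent nothing  (summary (just α) c q d) = from-α ∷ []
extendSummary-coherent (just α) (summary (just α) c q d) = from-α ∷ []
extendSummary-coherent (just β) (summary (just α) c q d) = from-α ∷ from-β ∷ []
extendSummary-coherent (just γ) (summary (just α) c q d) = from-α ∷ []
extendSummary-coherent (just δ) (summary (just α) c q d) = from-α ∷ []
extendSummary-coherent p₀ (summary nothing  c q d) = from-β ∷ []
extendSummary-coherent p₀ (summary (just β) c q d) = from-β ∷ []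
extendSummary-coherent p₀ (summary (just γ) c q d) = from-β ∷ []
extendSummary-coherent p₀ (summary (just δ) c q d) = from-β ∷ []

rowSummaries-coherent : ∀ p → All Coherent (rowSummaries p)
rowSummaries-coherent []       = from-α ∷ from-β ∷ []
rowSummaries-coherent (p₀ ∷ p) =
  concat⁺ (map⁺ (All.universal (extendSummary-coherent p₀) (rowSummaries p)))

one-term : ∀ a → + 1 * a + (+ 0 + (+ 0 + (+ 0 + (+ 0 + + 0)))) ≡ a + + 0
one-term = solve-∀

extendLeft-observe : ∀ {p₀} → IsAB p₀ → ∀ {o} → Coherent o → ∀ χ →
                     observe (extendLeft p₀ χ) o ≡ ∑∈ (extendSummary p₀ o) (observe χ)
extendLeft-observe α∈ (from-α {q} {d}) χ = one-term (χ (just α) true (just α ∷ q) d)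
extendLeft-observe β∈ (from-α {q} {d}) χ = two-terms
  (χ (just α) true (just β ∷ q) d) (χ (just α) true (just α ∷ q) d) (χ (just β) false (just β ∷ q) d)
  (χ (just γ) true (just γ ∷ q) d) (χ (just δ) false (just δ ∷ q) d)
  where
  two-terms : ∀ a b c d e → + 0 * a + (+ 1 * b + (+ 1 * c + (+ 0 * d + (+ 0 * e + + 0)))) ≡ b + (c + + 0)
  two-terms = solve-∀
extendLeft-observe α∈ (from-β {q} {d}) χ = one-term (χ (just β) false (just α ∷ q) d)
extendLeft-observe β∈ (from-β {q} {d}) χ = one-term (χ (just β) false (just β ∷ q) d)

rowSum-base : ∀ χ → rowSum 0 [] χ ≡ ∑∈ (rowSummaries []) (observe χ)
rowSum-base χ = diagonal-terms
  (χ (just α) true (just α ∷ []) (just α)) (χ (just β) false (just β ∷ []) (just β))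
  (χ (just γ) true (just γ ∷ []) (just γ)) (χ (just δ) false (just δ ∷ []) (just δ))
  where
  diagonal-terms : ∀ a b c d → + 0 + (+ 1 * a + (+ 1 * b + (+ 0 * c + (+ 0 * d + + 0)))) ≡ a + (b + + 0)
  diagonal-terms = solve-∀

rowSum≡∑rowSummaries : ∀ m p χ → All IsAB p → length p ≡ m → rowSum m p χ ≡ ∑∈ (rowSummaries p) (observe χ)
rowSum≡∑rowSummaries zero    []       χ []         refl = rowSum-base χ
rowSum≡∑rowSummaries (suc m) (p₀ ∷ p) χ (ab ∷ abs) eq   = begin
  rowSum (suc m) (p₀ ∷ p) χ
    ≡⟨ rowSum-∷ m p₀ p χ ⟩
  rowSum m p (extendLeft p₀ χ)
    ≡⟨ rowSum≡∑rowSummaries m p (extendLeft p₀ χ) abs (ℕP.suc-injective eq) ⟩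
  ∑∈ (rowSummaries p) (observe (extendLeft p₀ χ))
    ≡⟨ ∑∈-congᴬ (All.map (λ coh → extendLeft-observe ab coh χ) (rowSummaries-coherent p)) ⟩
  ∑[ o ∈ rowSummaries p ] ∑∈ (extendSummary p₀ o) (observe χ)
    ≡⟨ sym (∑∈-concatMap (extendSummary p₀) (rowSummaries p) (observe χ)) ⟩
  ∑∈ (rowSummaries (p₀ ∷ p)) (observe χ) ∎

-- Summing over whole tableaux

-- The profiles and numbers of •'s of the tableaux of size n of weight 1.
profiles : ℕ → List (List Cell × ℕ)
profiles zero    = ([] , 0) ∷ []
profiles (suc n) = concatMap (λ (p , t) → map (λ o → Summary.newProfile o , •? (Summary.diag o) +ℕ t) (rowSummaries p))
                             (profiles n)

ABProfile : ℕ → List Cell → Set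
ABProfile n p = All IsAB p × length p ≡ n

extendSummary-ABProfile : ∀ {p₀} → IsAB p₀ → ∀ n o → ABProfile n (Summary.newProfile o) →
                          All (ABProfile (suc n) ∘ Summary.newProfile) (extendSummary p₀ o)
extendSummary-ABProfile α∈ n (summary (just α) c q d) (ab , eq) = (α∈ ∷ ab , cong suc eq) ∷ []
extendSummary-ABProfile β∈ n (summary (just α) c q d) (ab , eq) = (α∈ ∷ ab , cong suc eq) ∷ (β∈ ∷ ab , cong suc eq) ∷ []
extendSummary-ABProfile p₀ n (summary nothing  c q d) (ab , eq) = (p₀ ∷ ab , cong suc eq) ∷ []
extendSummary-ABProfile p₀ n (summary (just β) c q d) (ab , eq) = (p₀ ∷ ab , cong suc eq) ∷ []
extendSummary-ABProfile p₀ n (summary (just γ) c q d) (ab , eq) = (p₀ ∷ ab , cong suc eq) ∷ []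
extendSummary-ABProfile p₀ n (summary (just δ) c q d) (ab , eq) = (p₀ ∷ ab , cong suc eq) ∷ []

rowSummaries-ABProfile : ∀ p → All IsAB p → All (ABProfile (suc (length p)) ∘ Summary.newProfile) (rowSummaries p)
rowSummaries-ABProfile []       []         = (α∈ ∷ [] , refl) ∷ (β∈ ∷ [] , refl) ∷ []
rowSummaries-ABProfile (p₀ ∷ p) (ab ∷ abs) =
  concat⁺ (map⁺ (All.map (λ {o} → extendSummary-ABProfile ab (suc (length p)) o) (rowSummaries-ABProfile p abs)))

profiles-ABProfile : ∀ n → All (ABProfile n ∘ proj₁) (profiles n)
profiles-ABProfile zero    = ([] , refl) ∷ []
profiles-ABProfile (suc n) = concat⁺ (map⁺ (All.map
  (λ {(p , t)} (ab , eq) → map⁺ (All.map (λ (ab′ , eq′) → ab′ , trans eq′ (cong suc eq)) (rowSummaries-ABProfile p ab)))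
  (profiles-ABProfile n)))

weighted≡∑profiles : ∀ n F → weighted n F ≡ ∑[ pt ∈ profiles n ] F (proj₁ pt) (proj₂ pt)
weighted≡∑profiles zero    F = cong (_+ + 0) (ℤP.*-identityˡ (F [] 0))
weighted≡∑profiles (suc n) F = begin
  weighted (suc n) F
    ≡⟨ weighted-suc n F ⟩
  weighted n (addRow n F)
    ≡⟨ weighted≡∑profiles n (addRow n F) ⟩
  ∑[ pt ∈ profiles n ] addRow n F (proj₁ pt) (proj₂ pt)
    ≡⟨ ∑∈-congᴬ (All.map (λ {(p , t)} (ab , eq) → rowSum≡∑rowSummaries n p (λ _ _ q d → F q (•? d +ℕ t)) ab eq)
                         (profiles-ABProfile n)) ⟩
  ∑[ pt ∈ profiles n ] ∑[ o ∈ rowSummaries (proj₁ pt) ] F (Summary.newProfile o) (•? (Summary.diag o) +ℕ proj₂ pt)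
    ≡⟨ sym (∑∈-cong (profiles n) (λ (p , t) → ∑∈-map (λ o → Summary.newProfile o , •? (Summary.diag o) +ℕ t)
                                                       (rowSummaries p) (λ pt → F (proj₁ pt) (proj₂ pt)))) ⟩
  ∑[ pt ∈ profiles n ] ∑∈ (map (λ o → Summary.newProfile o , •? (Summary.diag o) +ℕ proj₂ pt) (rowSummaries (proj₁ pt)))
                          (λ pt → F (proj₁ pt) (proj₂ pt))
    ≡⟨ sym (∑∈-concatMap _ (profiles n) (λ pt → F (proj₁ pt) (proj₂ pt))) ⟩
  ∑[ pt ∈ profiles (suc n) ] F (proj₁ pt) (proj₂ pt) ∎

countβ : List Cell → ℕ
countβ []             = 0
countβ (just β ∷ p) = suc (countβ p)
countβ (_ ∷ p)        = countβ p

observeCount : (Cell → ℕ → Cell → ℤ) → Summary → ℤ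
observeCount h (summary f c q d) = h f (countβ q) d

throughColumn : Cell → (Cell → ℕ → Cell → ℤ) → Cell → ℕ → Cell → ℤ
throughColumn (just β) h (just α) m d = h (just α) m d + (h (just β) (suc m) d + + 0)
throughColumn (just β) h _        m d = h (just β) (suc m) d + + 0
throughColumn _        h (just α) m d = h (just α) m d + + 0
throughColumn _        h _        m d = h (just β) m d + + 0

extendSummary-count : ∀ {p₀} → IsAB p₀ → ∀ h {o} → Coherent o →
  ∑∈ (extendSummary p₀ o) (observeCount h) ≡ observeCount (throughColumn p₀ h) o
extendSummary-count α∈ h from-α = refl
extendSummary-count β∈ h from-α = refl
extendSummary-count α∈ h from-β = refl
extendSummary-count β∈ h from-β = refl

rowCount : ℕ → (Cell → ℕ → Cell → ℤ) → ℤ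
rowCount m h = h (just α) 0 (just α) + (h (just β) (suc m) (just β) + (∑[ j < m ] h (just β) (suc j) (just α)))

rowCount-throughColumn : ∀ {p₀} → IsAB p₀ → ∀ p h →
                         rowCount (countβ p) (throughColumn p₀ h) ≡ rowCount (countβ (p₀ ∷ p)) h
rowCount-throughColumn α∈ p h = trans
  (cong (λ z → (h (just α) 0 (just α) + + 0) + ((h (just β) (suc m) (just β) + + 0) + z))
        (∑-cong m (λ j → ℤP.+-identityʳ (h (just β) (suc j) (just α)))))
  (rearrange (h (just α) 0 (just α)) (h (just β) (suc m) (just β)) _)
  where
  m = countβ p
  rearrange : ∀ a b c → (a + + 0) + ((b + + 0) + c) ≡ a + (b + c)
  rearrange = solve-∀
rowCount-throughColumn β∈ p h = trans
  (cong (λ z → (h (just α) 0 (just α) + (h (just β) 1 (just α) + + 0)) + ((h (just β) (suc (suc m)) (just β) + + 0) + z))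
        (∑-cong m (λ j → ℤP.+-identityʳ (h (just β) (suc (suc j)) (just α)))))
  (rearrange (h (just α) 0 (just α)) (h (just β) 1 (just α)) (h (just β) (suc (suc m)) (just β)) _)
  where
  m = countβ p
  rearrange : ∀ a b c d → (a + (b + + 0)) + ((c + + 0) + d) ≡ a + (c + (b + d))
  rearrange = solve-∀

∑rowSummaries-count : ∀ p → All IsAB p → ∀ h → ∑∈ (rowSummaries p) (observeCount h) ≡ rowCount (countβ p) h
∑rowSummaries-count []       []         h = refl
∑rowSummaries-count (p₀ ∷ p) (ab ∷ abs) h = begin
  ∑∈ (concatMap (extendSummary p₀) (rowSummaries p)) (observeCount h)
    ≡⟨ ∑∈-concatMap (extendSummary p₀) (rowSummaries p) (observeCount h) ⟩
  ∑[ o ∈ rowSummaries p ] ∑∈ (extendSummary p₀ o) (observeCount h)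
    ≡⟨ ∑∈-congᴬ (All.map (extendSummary-count ab h) (rowSummaries-coherent p)) ⟩
  ∑∈ (rowSummaries p) (observeCount (throughColumn p₀ h))
    ≡⟨ ∑rowSummaries-count p abs (throughColumn p₀ h) ⟩
  rowCount (countβ p) (throughColumn p₀ h)
    ≡⟨ rowCount-throughColumn ab p h ⟩
  rowCount (countβ (p₀ ∷ p)) h ∎

-- The effect of one more row on a function of (number of β's in the
-- profile, number of •'s).
addRowCount : (ℕ → ℕ → ℤ) → ℕ → ℕ → ℤ
addRowCount g m t = g (suc m) t + (∑[ j < suc m ] g j (suc t))

addRowCountⁿ : ℕ → (ℕ → ℕ → ℤ) → ℕ → ℕ → ℤ
addRowCountⁿ zero    g = g
addRowCountⁿ (suc n) g = addRowCountⁿ n (addRowCount g)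

addRowCountⁿ-suc : ∀ n g m t → addRowCountⁿ (suc n) g m t ≡ addRowCount (addRowCountⁿ n g) m t
addRowCountⁿ-suc zero    g m t = refl
addRowCountⁿ-suc (suc n) g m t = addRowCountⁿ-suc n (addRowCount g) m t

∑profiles : ℕ → (ℕ → ℕ → ℤ) → ℤ
∑profiles n g = ∑[ pt ∈ profiles n ] g (countβ (proj₁ pt)) (proj₂ pt)

∑profiles-suc : ∀ n g → ∑profiles (suc n) g ≡ ∑profiles n (addRowCount g)
∑profiles-suc n g = begin
  ∑profiles (suc n) g
    ≡⟨ ∑∈-concatMap _ (profiles n) (λ pt → g (countβ (proj₁ pt)) (proj₂ pt)) ⟩
  ∑[ pt ∈ profiles n ] ∑∈ (map (λ o → Summary.newProfile o , •? (Summary.diag o) +ℕ proj₂ pt) (rowSummaries (proj₁ pt)))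
                          (λ pt′ → g (countβ (proj₁ pt′)) (proj₂ pt′))
    ≡⟨ ∑∈-congᴬ (All.map (λ {(p , t)} (ab , _) → begin
         ∑∈ (map (λ o → Summary.newProfile o , •? (Summary.diag o) +ℕ t) (rowSummaries p))
            (λ pt′ → g (countβ (proj₁ pt′)) (proj₂ pt′))
           ≡⟨ ∑∈-map (λ o → Summary.newProfile o , •? (Summary.diag o) +ℕ t) (rowSummaries p) _ ⟩
         ∑∈ (rowSummaries p) (λ o → g (countβ (Summary.newProfile o)) (•? (Summary.diag o) +ℕ t))
           ≡⟨ ∑rowSummaries-count p ab (λ _ m d → g m (•? d +ℕ t)) ⟩
         g 0 (suc t) + (g (suc (countβ p)) t + (∑[ j < countβ p ] g (suc j) (suc t)))
           ≡⟨ x∙yz≈y∙xz (g 0 (suc t)) (g (suc (countβ p)) t) _ ⟩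
         addRowCount g (countβ p) t ∎)
       (profiles-ABProfile n)) ⟩
  ∑profiles n (addRowCount g) ∎

∑profiles≡addRowCountⁿ : ∀ n g → ∑profiles n g ≡ addRowCountⁿ n g 0 0
∑profiles≡addRowCountⁿ zero    g = ℤP.+-identityʳ (g 0 0)
∑profiles≡addRowCountⁿ (suc n) g = trans (∑profiles-suc n g) (∑profiles≡addRowCountⁿ n (addRowCount g))

exactly : ℕ → ℕ → ℤ
exactly k t = if t ≡ᵇ k then + 1 else + 0

exactly-below : ∀ t k → k < t → exactly k t ≡ + 0
exactly-below (suc t) zero    _         = refl
exactly-below (suc t) (suc k) (s≤s k<t) = exactly-below t k k<t

exactly-at : ∀ t r m → exactly (t +ℕ r) t ≡ ways 0 m r
exactly-at zero    zero    m = refl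
exactly-at zero    (suc r) m = refl
exactly-at (suc t) r       m = exactly-at t r m

addRowCountⁿ-past : ∀ n m t k → k < t → addRowCountⁿ n (λ _ → exactly k) m t ≡ + 0
addRowCountⁿ-past zero    m t k k<t = exactly-below t k k<t
addRowCountⁿ-past (suc n) m t k k<t = trans (addRowCountⁿ-suc n (λ _ → exactly k) m t)
  (cong₂ _+_ (addRowCountⁿ-past n (suc m) t k k<t)
             (∑-vanishing (suc m) _ (λ j _ → addRowCountⁿ-past n j (suc t) k (ℕP.m<n⇒m<1+n k<t))))

-- ways n m r counts what is still to come when t of the k wanted •'s are
-- already there, r = k − t.
addRowCountⁿ≡ways : ∀ n m t r → addRowCountⁿ n (λ _ → exactly (t +ℕ r)) m t ≡ ways n m r
addRowCountⁿ≡ways zero    m t r = exactly-at t r m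
addRowCountⁿ≡ways (suc n) m t r = trans (addRowCountⁿ-suc n (λ _ → exactly (t +ℕ r)) m t)
  (cong₂ _+_ (addRowCountⁿ≡ways n (suc m) t r) (newDot r))
  where
  newDot : ∀ r → ∑[ j < suc m ] addRowCountⁿ n (λ _ → exactly (t +ℕ r)) j (suc t)
                 ≡ shift (λ k′ → ∑[ j < suc m ] ways n j k′) r
  newDot zero    = ∑-vanishing (suc m) _ (λ j _ →
    addRowCountⁿ-past n j (suc t) (t +ℕ 0) (s≤s (ℕP.≤-reflexive (ℕP.+-identityʳ t))))
  newDot (suc r) = ∑-cong (suc m) (λ j →
    subst (λ k → addRowCountⁿ n (λ _ → exactly k) j (suc t) ≡ ways n j r) (sym (ℕP.+-suc t r))
          (addRowCountⁿ≡ways n j (suc t) r))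

genZ≡ways₀ : ∀ n k → genZ n k ≡ ways₀ n k
genZ≡ways₀ n k = begin
  genZ n k
    ≡⟨ sumℤ-filter (λ T → typeCount n T ≟ k) (staircaseTableaux n) (wt n) ⟩
  ∑[ T ∈ staircaseTableaux n ] [ typeCount n T ≡ᵇ k ]· wt n T
    ≡⟨ sumℤ-filter (λ T → T? (isStaircase n T)) (allFillings n) (λ T → [ typeCount n T ≡ᵇ k ]· wt n T) ⟩
  ∑[ T ∈ allFillings n ] [ isStaircase n T ]· [ typeCount n T ≡ᵇ k ]· wt n T
    ≡⟨ ∑∈-cong (allFillings n) (λ T → cong [ isStaircase n T ]·_ ([]·≡* (typeCount n T ≡ᵇ k) (wt n T))) ⟩
  weighted n (λ _ → exactly k)
    ≡⟨ weighted≡∑profiles n (λ _ → exactly k) ⟩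
  ∑profiles n (λ _ → exactly k)
    ≡⟨ ∑profiles≡addRowCountⁿ n (λ _ → exactly k) ⟩
  addRowCountⁿ n (λ _ → exactly k) 0 0
    ≡⟨ addRowCountⁿ≡ways n 0 0 k ⟩
  ways₀ n k ∎
  where
  []·≡* : ∀ b x → [ b ]· x ≡ x * (if b then + 1 else + 0)
  []·≡* true  x = sym (ℤP.*-identityʳ x)
  []·≡* false x = sym (ℤP.*-zeroʳ x)

corollary3p9 : Σ Series IsT
    × ((t : Series) → IsT t → genZ ≈ₛ ((oneₛ +ₛ t) *ₛ (oneₛ +ₛ (yₛ *ₛ t))))
corollary3p9 = (wₛ *ₛ ways₀ , w·ways₀-isT) , λ t isT n k → trans (genZ≡ways₀ n k) (ways₀≈φ t isT n k)
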